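{- Let $n_1,n_2,\ldots$ be a sequence of integers with the dichotomy property described in the context. Consider the algorithm $\mathcal A$ described in the context, run on a valid W$k$S-RSP input $(\sigma_1,\ell_1),\dots,(\sigma_T,\ell_T)$ with $\ell_1=k$, and let $X^\ell$, $Y^\ell$ be the numbers of forced and unforced movements, respectively, of the algorithm's $\ell$-th server. Then for every $\ell\in\{1,\dots,k\}$, $$\mathbb E[Y^\ell]\le H(n_\ell)\cdot\mathbb E[X^\ell],$$ where $H(n)=1+\tfrac12+\dots+\tfrac1n$.
   Context: $U$ is a finite set (uniform metric). A hierarchical service pattern over $[1,s+1)$ is a $k$-tuple $\mathcal I=(\mathcal I^1,\dots,\mathcal I^k)$ of partitions of $[1,s+1)$ into left-closed right-open integer intervals with $\mathcal I^\ell$ refining $\mathcal I^{\ell+1}$. A labeling maps the multiset $\mathcal I^1\uplus\dots\uplus\mathcal I^k$ to $U$; it is feasible with respect to $(\sigma_1,\dots,\sigma_s)$ if each $r\le s$ lies in some interval labeled $\sigma_r$. The $\ell$-extension of a pattern $\mathcal I_{t-1}$ over $[1,t)$ adds $[t,t+1)$ as a new interval to each level $i\le\ell$ and extends the last interval of each level $i>\ell$ by $[t,t+1)$. A valid W$k$S-RSP input is a sequence of pairs $(\sigma_t,\ell_t)\in U\times\{0,\dots,k\}$ such that, with $\mathcal I_t$ the $\ell_t$-extension of $\mathcal I_{t-1}$, each $\mathcal I_t$ is feasible with respect to $\rho_t=(\sigma_1,\dots,\sigma_t)$. $L^i_t$ is the last interval of $\mathcal I^i_t$. $Q^\ell_t(p^{\ell+1},\dots,p^k)$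 is the set of $p^\ell\in U$ such that some feasible labeling $\gamma$ of $\mathcal I_t$ w.r.t. $\rho_t$ has $\gamma(L^i_t)=p^i$ for all $i\in\{\ell,\dots,k\}$. Dichotomy property of $(n_\ell)$: for every $k$, every $t$, every request sequence $\rho_t$, every hierarchical service pattern $\mathcal I_t$ over $[1,t+1)$, every $\ell\le k$ and every $p^{\ell+1},\dots,p^k\in U$, the set $Q^\ell_t(p^{\ell+1},\dots,p^k)$ is either all of $U$ or has size at most $n_\ell$. Algorithm $\mathcal A$: $s^\ell_t$ denotes the position of its $\ell$-th server after round $t$. In round $t$: set flag $:=$ false; for $\ell=k,k-1,\dots,1$: compute $Q:=Q^\ell_t(s^{\ell+1}_t,\dots,s^k_t)$; if flag is true or $\ell\le\ell_t$, set $s^\ell_t$ to a uniformly random point of $Q$ (this execution counts as one forced movement of server $\ell$); else if $s^\ell_{t-1}\notin Q$, set $s^\ell_t$ to a uniformly random point of $Q$ (this counts as one unforced movement of server $\ell$) and set flag $:=$ true; else set $s^\ell_t:=s^\ell_{t-1}$. -}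

module Defs where

open import Data.Bool.Base using (Bool; true; false; if_then_else_; _∨_; not)
open import Data.Nat.Base as ℕ using (ℕ; zero; suc; _<ᵇ_; _≤_; _<_)
open import Data.Nat.Properties using (_<?_) renaming (_≟_ to _≟ⁿ_)
open import Data.Fin.Base using (Fin; zero; suc; toℕ; fromℕ)
open import Data.Fin.Properties using (any?; all?) renaming (_≟_ to _≟ᶠ_)
open import Data.Bool.Properties using () renaming (_≟_ to _≟ᵇ_)
open import Data.Product.Base using (Σ; ∃; _×_; _,_; proj₁; proj₂)
open import Data.List.Base using (List; []; _∷_; map; concatMap; allFin; filter; length; foldl; foldr; reverse)
open import Data.Vec.Base using (Vec; lookup; _[_]≔_; replicate)
open import Data.Integer.Base using (+_)
open import Data.Rational.Base using (ℚ; _/_; 0ℚ; 1ℚ) renaming (_+_ to _+ℚ_; _*_ to _*ℚ_)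
open import Relation.Nullary.Decidable.Core using (Dec; yes; no; does; _×-dec_; _→-dec_; map′)
open import Relation.Binary.PropositionalEquality using (_≡_; refl; sym; trans)
open import Data.Unit.Base using (⊤; tt)
open import Data.Sum.Base using (_⊎_)

-- Conventions
-- U = Fin m (a finite set; the metric is uniform, so only the set matters).
-- Levels 1..k are represented by i : Fin k (level = toℕ i + 1).
-- Times 1..s are represented by r : Fin s (time = toℕ r + 1).
-- A k-level pattern over [1,s+1) is represented by its start indicators:
-- P i r = true iff some interval of level (i+1) starts at time (r+1).

Pattern : ℕ → ℕ → Set
Pattern k s = Fin k → Fin s → Bool

-- Hierarchical service pattern: each level partitions [1,s+1) into
-- intervals (so an interval starts at time 1), and level ℓ refines
-- level ℓ+1 (every start point of a higher level is a start point of
-- every lower level).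
HSP : ∀ {k s} → Pattern k s → Set
HSP {k} {s} P =
  (∀ (i : Fin k) (r : Fin s) → toℕ r ≡ 0 → P i r ≡ true) ×
  (∀ (i j : Fin k) (r : Fin s) → toℕ i ≤ toℕ j → P j r ≡ true → P i r ≡ true)

-- A labeling of the multiset of intervals, represented as the function
-- giving, for each level i and time r, the label of the level-i interval
-- containing r; it must be constant on each interval (i.e. it can only
-- change at start points).
IsLabeling : ∀ {k s m} → Pattern k s → (Fin k → Fin s → Fin m) → Set
IsLabeling {k} {s} P γ =
  ∀ (i : Fin k) (r r' : Fin s) → toℕ r' ≡ suc (toℕ r) → P i r' ≡ false → γ i r' ≡ γ i r

Feasible : ∀ {k s m} → (Fin s → Fin m) → (Fin k → Fin s → Fin m) → Set
Feasible {k} {s} ρ γ = ∀ (r : Fin s) → ∃ λ (i : Fin k) → γ i r ≡ ρ r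

-- Labeling γ witnesses q ∈ Q^ℓ_t(p^{ℓ+1},…,p^k) for a pattern over
-- [1,t+1) with t = suc n.  The label of the last interval L^i_t is γ i (last time).
-- p : Fin k → U; only its entries at levels > ℓ are used.
GoodQ : ∀ {k n m} → Pattern k (suc n) → (Fin (suc n) → Fin m) →
        Fin k → (Fin k → Fin m) → Fin m → (Fin k → Fin (suc n) → Fin m) → Set
GoodQ {k} {n} P ρ ℓ p q γ =
  IsLabeling P γ × Feasible ρ γ × γ ℓ (fromℕ n) ≡ q ×
  (∀ (i : Fin k) → toℕ ℓ < toℕ i → γ i (fromℕ n) ≡ p i)

InQ : ∀ {k n m} → Pattern k (suc n) → (Fin (suc n) → Fin m) →
      Fin k → (Fin k → Fin m) → Fin m → Set
InQ P ρ ℓ p q = ∃ λ γ → GoodQ P ρ ℓ p q γ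

HasFeasibleLabeling : ∀ {k s m} → Pattern k s → (Fin s → Fin m) → Set
HasFeasibleLabeling P ρ = ∃ λ γ → IsLabeling P γ × Feasible ρ γ

DecEx : (B : Set) → (B → B → Set) → Set₁
DecEx B _~_ = (P : B → Set) → (∀ x y → x ~ y → P x → P y) →
              (∀ x → Dec (P x)) → Dec (∃ P)

decExFin : ∀ b → DecEx (Fin b) _≡_
decExFin b P _ P? = any? P?

private
  cons : ∀ {a} {B : Set} → B → (Fin a → B) → Fin (suc a) → B
  cons x g zero = x
  cons x g (suc i) = g i

decExFun : ∀ a {B : Set} {_~_ : B → B → Set} → (∀ x → x ~ x) →
           DecEx B _~_ → DecEx (Fin a → B) (λ f g → ∀ x → f x ~ g x)
decExFun zero {_~_ = _~_} rfl dB P ext P? with P? (λ ())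
... | yes p = yes ((λ ()) , p)
... | no ¬p = no λ { (f , pf) → ¬p (ext f (λ ()) (λ ()) pf) }
decExFun (suc a) {_~_ = _~_} rfl dB P ext P? =
  map′ (λ { (x , g , pg) → cons x g , pg })
       (λ { (f , pf) → f zero , (λ i → f (suc i)) ,
              ext f (cons (f zero) (λ i → f (suc i))) (λ { zero → rfl _ ; (suc i) → rfl _ }) pf })
       (dB (λ x → ∃ λ g → P (cons x g))
           (λ x y x~y → λ { (g , pg) → g , ext (cons x g) (cons y g)
                                         (λ { zero → x~y ; (suc i) → rfl _ }) pg })
           (λ x → decExFun a rfl dB (λ g → P (cons x g))
                    (λ g h g~h → ext (cons x g) (cons x h) (λ { zero → rfl _ ; (suc i) → g~h i }))
                    (λ g → P? (cons x g))))

private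
  goodExt : ∀ {k n m} (P : Pattern k (suc n)) ρ ℓ p (q : Fin m) γ δ →
            (∀ i r → γ i r ≡ δ i r) → GoodQ P ρ ℓ p q γ → GoodQ P ρ ℓ p q δ
  goodExt P ρ ℓ p q γ δ e (c , f , l , h) =
    (λ i r r' s z → trans (sym (e i r')) (trans (c i r r' s z) (e i r))) ,
    (λ r → proj₁ (f r) , trans (sym (e (proj₁ (f r)) r)) (proj₂ (f r))) ,
    trans (sym (e ℓ _)) l ,
    (λ i lt → trans (sym (e i _)) (h i lt))

  goodQ? : ∀ {k n m} (P : Pattern k (suc n)) ρ ℓ p (q : Fin m) γ → Dec (GoodQ P ρ ℓ p q γ)
  goodQ? P ρ ℓ p q γ =
    all? (λ i → all? (λ r → all? (λ r' →
      (toℕ r' ≟ⁿ suc (toℕ r)) →-dec (P i r' ≟ᵇ false) →-dec (γ i r' ≟ᶠ γ i r)))) ×-dec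
    all? (λ r → any? (λ i → γ i r ≟ᶠ ρ r)) ×-dec
    (γ ℓ _ ≟ᶠ q) ×-dec
    all? (λ i → (toℕ ℓ <? toℕ i) →-dec (γ i _ ≟ᶠ p i))

InQ? : ∀ {k n m} (P : Pattern k (suc n)) ρ ℓ p (q : Fin m) → Dec (InQ P ρ ℓ p q)
InQ? {k} {n} {m} P ρ ℓ p q =
  decExFun k (λ f x → refl) (decExFun (suc n) (λ _ → refl) (decExFin m))
    (GoodQ P ρ ℓ p q) (goodExt P ρ ℓ p q) (goodQ? P ρ ℓ p q)

-- Q^ℓ_t(p) as an explicit list (in increasing order, without repetition).
Qlist : ∀ {k n m} → Pattern k (suc n) → (Fin (suc n) → Fin m) →
        Fin k → (Fin k → Fin m) → List (Fin m)
Qlist {m = m} P ρ ℓ p = filter (InQ? P ρ ℓ p) (allFin m)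

-- Dichotomy property of a sequence n_1, n_2, … (n ℓ = n_ℓ; n 0 unused)
-- for the finite set U = Fin m.

Dichotomy : ℕ → (ℕ → ℕ) → Set
Dichotomy m nseq =
  ∀ (k t : ℕ) (ρ : Fin (suc t) → Fin m) (P : Pattern k (suc t)) → HSP P →
  ∀ (ℓ : Fin k) (p : Fin k → Fin m) →
  (∀ q → InQ P ρ ℓ p q) ⊎ length (Qlist P ρ ℓ p) ≤ nseq (suc (toℕ ℓ))

snoc : ∀ {A : Set} {s} → (Fin s → A) → A → Fin (suc s) → A
snoc {s = zero} f a zero = a
snoc {s = suc s} f a zero = f zero
snoc {s = suc s} f a (suc r) = snoc (λ r' → f (suc r')) a r

-- ℓ-extension (ℓ ∈ {0..k}): the new time is a start point exactly at levels ≤ ℓ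
-- (new interval at levels ≤ ℓ; last interval extended at levels > ℓ).
extend : ∀ {k s} → Pattern k s → Fin (suc k) → Pattern k (suc s)
extend P ℓ i = snoc (P i) (toℕ i <ᵇ toℕ ℓ)

emptyPattern : ∀ k → Pattern k 0
emptyPattern k i ()

emptyReq : ∀ {m} → Fin 0 → Fin m
emptyReq ()

Input : ℕ → ℕ → Set
Input m k = List (Fin m × Fin (suc k))

ValidFrom : ∀ {m k s} → Pattern k s → (Fin s → Fin m) → Input m k → Set
ValidFrom P ρ [] = ⊤
ValidFrom P ρ ((σ , ℓ) ∷ rest) =
  HasFeasibleLabeling (extend P ℓ) (snoc ρ σ) × ValidFrom (extend P ℓ) (snoc ρ σ) rest

Valid : ∀ {m k} → Input m k → Set
Valid {k = k} inp = ValidFrom (emptyPattern k) emptyReq inp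

Dist : Set → Set
Dist A = List (ℚ × A)

return : ∀ {A : Set} → A → Dist A
return a = (1ℚ , a) ∷ []

_>>=_ : ∀ {A B : Set} → Dist A → (A → Dist B) → Dist B
d >>= f = concatMap (λ { (w , a) → map (λ { (w' , b) → (w *ℚ w' , b) }) (f a) }) d

-- uniform distribution on a list (of distinct elements); on the empty list,
-- by convention, the point mass at the default (never happens on valid inputs).
uniformOr : ∀ {A : Set} → A → List A → Dist A
uniformOr d [] = return d
uniformOr d (x ∷ xs) = map (λ y → (+ 1 / length (x ∷ xs) , y)) (x ∷ xs)

𝔼 : ∀ {A : Set} → Dist A → (A → ℕ) → ℚ
𝔼 d f = foldr (λ { (w , a) acc → w *ℚ (+ f a / 1) +ℚ acc }) 0ℚ d

H : ℕ → ℚ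
H zero = 0ℚ
H (suc n) = H n +ℚ (+ 1 / suc n)

record Config (m k : ℕ) : Set where
  constructor config
  field
    pos : Vec (Fin m) k   -- server positions (server i serves level i+1)
    X   : Vec ℕ k
    Y   : Vec ℕ k
open Config public

incr : ∀ {k} → Vec ℕ k → Fin k → Vec ℕ k
incr v i = v [ i ]≔ suc (lookup v i)

step : ∀ {m k n} → Pattern k (suc n) → (Fin (suc n) → Fin m) → Fin (suc k) →
       Config m k × Bool → Fin k → Dist (Config m k × Bool)
step P ρ ℓt (c , flag) i =
  let Q   = Qlist P ρ i (lookup (pos c))
      old = lookup (pos c) i
  in if flag ∨ (toℕ i <ᵇ toℕ ℓt)
     then (uniformOr old Q >>= λ q →
             return (config (pos c [ i ]≔ q) (incr (X c) i) (Y c) , flag))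
     else (if not (does (InQ? P ρ i (lookup (pos c)) old))
           then (uniformOr old Q >>= λ q →
                   return (config (pos c [ i ]≔ q) (X c) (incr (Y c) i) , true))
           else return (c , flag))

round : ∀ {m k n} → Pattern k (suc n) → (Fin (suc n) → Fin m) → Fin (suc k) →
        Config m k → Dist (Config m k)
round {k = k} P ρ ℓt c =
  foldl (λ d i → d >>= λ st → step P ρ ℓt st i) (return (c , false)) (reverse (allFin k))
  >>= λ { (c' , _) → return c' }

runFrom : ∀ {m k s} → Pattern k s → (Fin s → Fin m) → Config m k → Input m k → Dist (Config m k)
runFrom P ρ c [] = return c
runFrom P ρ c ((σ , ℓ) ∷ rest) =
  round (extend P ℓ) (snoc ρ σ) ℓ c >>= λ c' → runFrom (extend P ℓ) (snoc ρ σ) c' rest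

run : ∀ {m k} → Vec (Fin m) k → Input m k → Dist (Config m k)
run {k = k} init inp = runFrom (emptyPattern k) emptyReq (config init (replicate k 0) (replicate k 0)) inp

{-# OPTIONS --safe #-}
-- Fix a server ℓ, let N = n_ℓ and call Y − H(N)·X, counted for server ℓ, its excess.  By induction
-- on the remaining input: if server ℓ sits at a uniformly random point of its current candidate
-- set Q, |Q| = a, then its expected final excess is at most its current excess plus φ(a), where
-- φ(a) = H(a) − 1 for a ≤ N and φ(a) = H(N) for a > N.  A forced move costs H(N) ≥ φ on the X side
-- and re-randomises the server, so it keeps the bound.  In a round that does not force server ℓ,
-- the servers above it stay put and the new candidate set is some Q′ ⊆ Q, |Q′| = b; server ℓ moves
-- (at cost 1) exactly from the a − b positions outside Q′, and a·φ(b) + (a − b) ≤ a·φ(a) because,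
-- by the dichotomy, b ≤ N or Q′ = Q.  Servers below ℓ never influence server ℓ, and in the first
-- round every server is forced, so the expected excess at the end is at most 0.
module Submission where

open import Defs
open import Data.Bool.Base using (Bool; true; false; _∨_)
open import Data.Bool.Properties using (T-≡; ∨-zeroʳ)
open import Data.Nat.Base as ℕ using (ℕ; zero; suc; z≤n; s≤s; _<ᵇ_)
import Data.Nat.Properties as ℕ
import Data.Nat.Coprimality as Coprime
open import Data.Integer.Base as ℤ using (+≤+)
import Data.Integer.Properties as ℤ
open import Data.Rational.Base as ℚ using (ℚ; mkℚ; 0ℚ; 1ℚ; _+_; _*_; _-_; -_; _≤_; _/_; *≤*)
import Data.Rational.Properties as ℚ
open import Data.Rational.Solver using (module +-*-Solver)
open import Data.Fin.Base using (Fin; zero; suc; toℕ; fromℕ; inject₁)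
import Data.Fin.Properties as Fin
open import Data.Vec.Base using (Vec; lookup; _[_]≔_; replicate)
import Data.Vec.Properties as Vec
open import Data.List.Base using (List; []; _∷_; map; _++_; length; filter; allFin; foldr; foldl; reverse)
open import Data.List.Properties
  using (filter-≐; filter-some; filter-accept; filter-reject; filter-none; map-tabulate; map-++; reverse-foldl; foldr-++)
open import Data.List.Relation.Unary.All as All using (All; []; _∷_)
open import Data.List.Relation.Unary.All.Properties as All using (all-filter)
open import Data.List.Membership.Propositional using (lose)
open import Data.List.Membership.Propositional.Properties using (∈-allFin)
open import Data.Product.Base using (∃; ∃₂; _×_; _,_; proj₁; proj₂)
open import Data.Sum.Base using (_⊎_; inj₁; inj₂)
open import Data.Empty using (⊥-elim)
open import Function.Base using (id; _∘_; case_of_)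
open import Function.Bundles using (Equivalence)
open import Relation.Nullary.Decidable.Core using (Dec; does; yes; no)
open import Relation.Nullary.Negation.Core using (¬_)
open import Relation.Unary using (Decidable)
open import Relation.Unary.Properties using (∁?)
open import Relation.Binary.PropositionalEquality

open +-*-Solver

-- Both are written as in Defs (𝔼, H, uniformOr), so that they unfold to the same terms.
ι : ℕ → ℚ
ι n = ℤ.+ n / 1

1/[1+_] : ℕ → ℚ
1/[1+ n ] = ℤ.+ 1 / suc n

ι≡mkℚ : ∀ n → ι n ≡ mkℚ (ℤ.+ n) 0 (Coprime.sym (Coprime.1-coprimeTo n))
ι≡mkℚ n = ℚ.normalize-coprime (Coprime.sym (Coprime.1-coprimeTo n))

1/[1+n]≡mkℚ : ∀ n → 1/[1+ n ] ≡ mkℚ (ℤ.+ 1) n (Coprime.1-coprimeTo (suc n))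
1/[1+n]≡mkℚ n = ℚ.normalize-coprime (Coprime.1-coprimeTo (suc n))

ι-+ : ∀ a b → ι (a ℕ.+ b) ≡ ι a + ι b
ι-+ a b rewrite ι≡mkℚ a | ι≡mkℚ b =
  trans (ι≡mkℚ (a ℕ.+ b)) (sym (trans (ℚ./-cong numerator refl) (ι≡mkℚ (a ℕ.+ b))))
  where
  numerator : ℤ.+ a ℤ.* ℤ.+ 1 ℤ.+ ℤ.+ b ℤ.* ℤ.+ 1 ≡ ℤ.+ (a ℕ.+ b)
  numerator = trans (cong₂ ℤ._+_ (ℤ.*-identityʳ (ℤ.+ a)) (ℤ.*-identityʳ (ℤ.+ b))) (sym (ℤ.pos-+ a b))

ι-suc : ∀ n → ι (suc n) ≡ 1ℚ + ι n
ι-suc = ι-+ 1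

ι-mono-≤ : ∀ {a b} → a ℕ.≤ b → ι a ≤ ι b
ι-mono-≤ {a} {b} a≤b rewrite ι≡mkℚ a | ι≡mkℚ b = *≤* (ℤ.*-monoʳ-≤-nonNeg (ℤ.+ 1) (+≤+ a≤b))

0≤ι : ∀ n → 0ℚ ≤ ι n
0≤ι n = ι-mono-≤ {0} {n} z≤n

0≤1/[1+n] : ∀ n → 0ℚ ≤ 1/[1+ n ]
0≤1/[1+n] n = ℚ.nonNegative⁻¹ _ {{ℚ.normalize-nonNeg 1 (suc n)}}

1/[1+n]*ι[1+n]≡1 : ∀ n → (1/[1+ n ]) * ι (suc n) ≡ 1ℚ
1/[1+n]*ι[1+n]≡1 n rewrite 1/[1+n]≡mkℚ n | ι≡mkℚ (suc n) =
  ℚ.*-inverseˡ (mkℚ (ℤ.+ suc n) 0 (Coprime.sym (Coprime.1-coprimeTo (suc n))))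

1/[1+n]-antitone : ∀ n → 1/[1+ suc n ] ≤ 1/[1+ n ]
1/[1+n]-antitone n rewrite 1/[1+n]≡mkℚ (suc n) | 1/[1+n]≡mkℚ n =
  *≤* (+≤+ (s≤s (ℕ.+-monoˡ-≤ 0 (ℕ.n≤1+n n))))

H[n]≤H[1+n] : ∀ n → H n ≤ H (suc n)
H[n]≤H[1+n] n = begin
  H n                     ≡⟨ ℚ.+-identityʳ (H n) ⟨
  H n + 0ℚ                ≤⟨ ℚ.+-monoʳ-≤ (H n) (0≤1/[1+n] n) ⟩
  H n + 1/[1+ n ]       ∎
  where open ℚ.≤-Reasoning

H-mono-≤ : ∀ {a b} → a ℕ.≤ b → H a ≤ H b
H-mono-≤ a≤b = go (ℕ.≤⇒≤′ a≤b)
  where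
  go : ∀ {a b} → a ℕ.≤′ b → H a ≤ H b
  go ℕ.≤′-refl = ℚ.≤-refl
  go {b = suc b} (ℕ.≤′-step a≤′b) = ℚ.≤-trans (go a≤′b) (H[n]≤H[1+n] b)

0≤H : ∀ n → 0ℚ ≤ H n
0≤H n = H-mono-≤ {0} {n} z≤n

1≤H : ∀ {n} → 1 ℕ.≤ n → 1ℚ ≤ H n
1≤H 1≤n = H-mono-≤ 1≤n

H-tail-lowerBound : ∀ b d x → 0ℚ ≤ x → x ≤ 1/[1+ b ℕ.+ d ] →
                    H b + ι (suc d) * x ≤ H (suc (b ℕ.+ d))
H-tail-lowerBound b zero x _ x≤ rewrite ℕ.+-identityʳ b =
  ℚ.+-monoʳ-≤ (H b) (subst (_≤ 1/[1+ b ]) (sym (ℚ.*-identityˡ x)) x≤)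
H-tail-lowerBound b (suc d) x 0≤x x≤ = begin
  H b + ι (suc (suc d)) * x
    ≡⟨ cong (λ y → H b + y * x) (ι-suc (suc d)) ⟩
  H b + (1ℚ + ι (suc d)) * x
    ≡⟨ solve 3 (λ h i y → h :+ (con 1ℚ :+ i) :* y := (h :+ i :* y) :+ y) refl (H b) (ι (suc d)) x ⟩
  (H b + ι (suc d) * x) + x
    ≤⟨ ℚ.+-mono-≤ (H-tail-lowerBound b d x 0≤x x≤′) x≤″ ⟩
  H (suc (b ℕ.+ d)) + 1/[1+ suc (b ℕ.+ d) ]
    ≡⟨ cong (λ n → H (suc n)) (sym (ℕ.+-suc b d)) ⟩
  H (suc (b ℕ.+ suc d)) ∎
  where
  open ℚ.≤-Reasoning
  x≤″ : x ≤ 1/[1+ suc (b ℕ.+ d) ]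
  x≤″ = subst (λ n → x ≤ 1/[1+ n ]) (ℕ.+-suc b d) x≤
  x≤′ : x ≤ 1/[1+ b ℕ.+ d ]
  x≤′ = ℚ.≤-trans x≤″ (1/[1+n]-antitone (b ℕ.+ d))

x≤x+y : ∀ x {y} → 0ℚ ≤ y → x ≤ x + y
x≤x+y x {y} 0≤y = subst (_≤ x + y) (ℚ.+-identityʳ x) (ℚ.+-monoʳ-≤ x 0≤y)

x-y≤x : ∀ x {y} → 0ℚ ≤ y → x - y ≤ x
x-y≤x x {y} 0≤y = subst (x - y ≤_) (solve 2 (λ x y → (x :- y) :+ y := x) refl x y) (x≤x+y (x - y) 0≤y)

x≤y⇒0≤y-x : ∀ {x y} → x ≤ y → 0ℚ ≤ y - x
x≤y⇒0≤y-x {x} {y} x≤y = subst (_≤ y - x) (ℚ.+-inverseʳ x) (ℚ.+-monoˡ-≤ (- x) x≤y)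

*-monoˡ-≤-0≤ : ∀ {c x y} → 0ℚ ≤ c → x ≤ y → c * x ≤ c * y
*-monoˡ-≤-0≤ {c} 0≤c = ℚ.*-monoˡ-≤-nonNeg c {{ℚ.nonNegative 0≤c}}

0≤x*y : ∀ {x y} → 0ℚ ≤ x → 0ℚ ≤ y → 0ℚ ≤ x * y
0≤x*y {x} {y} 0≤x 0≤y =
  ℚ.nonNegative⁻¹ (x * y) {{ℚ.nonNeg*nonNeg⇒nonNeg x {{ℚ.nonNegative 0≤x}} y {{ℚ.nonNegative 0≤y}}}}

potential : ℕ → ℕ → ℚ
potential N a with a ℕ.≤? N
... | yes _ = H a - 1ℚ
... | no  _ = H N

potential-≤ : ∀ {N a} → a ℕ.≤ N → potential N a ≡ H a - 1ℚ
potential-≤ {N} {a} a≤N with a ℕ.≤? N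
... | yes _   = refl
... | no  a≰N = ⊥-elim (a≰N a≤N)

0≤potential : ∀ N {a} → 1 ℕ.≤ a → 0ℚ ≤ potential N a
0≤potential N {a} 1≤a with a ℕ.≤? N
... | yes _ = x≤y⇒0≤y-x (1≤H 1≤a)
... | no  _ = 0≤H N

potential≤H : ∀ N a → potential N a ≤ H N
potential≤H N a with a ℕ.≤? N
... | yes a≤N = ℚ.≤-trans (x-y≤x (H a) (0≤ι 1)) (H-mono-≤ a≤N)
... | no  _   = ℚ.≤-refl

potential-growth : ∀ N b r → 1 ℕ.≤ b → b ℕ.≤ N ⊎ r ≡ 0 →
                   ι (b ℕ.+ r) * potential N b + ι r ≤ ι (b ℕ.+ r) * potential N (b ℕ.+ r)
potential-growth N b zero _ _ rewrite ℕ.+-identityʳ b = ℚ.≤-reflexive (ℚ.+-identityʳ _)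
potential-growth N b (suc r) _ (inj₂ ())
potential-growth N b (suc r) _ (inj₁ b≤N) rewrite potential-≤ b≤N | ℕ.+-suc b r
  with suc (b ℕ.+ r) ℕ.≤? N
... | yes a≤N = begin
  ι a * (H b - 1ℚ) + ι (suc r)
    ≡⟨ cong (λ z → ι a * (H b - 1ℚ) + z) (sym (trans (cong (ι (suc r) *_) v*a≡1) (ℚ.*-identityʳ _))) ⟩
  ι a * (H b - 1ℚ) + ι (suc r) * (v * ι a)
    ≡⟨ solve 4 (λ A h R V → A :* (h :- con 1ℚ) :+ R :* (V :* A) := A :* (h :+ R :* V) :- A) refl (ι a) (H b) (ι (suc r)) v ⟩
  ι a * (H b + ι (suc r) * v) - ι a
    ≤⟨ ℚ.+-monoˡ-≤ (- ι a) (*-monoˡ-≤-0≤ (0≤ι a) (H-tail-lowerBound b r v (0≤1/[1+n] (b ℕ.+ r)) ℚ.≤-refl)) ⟩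
  ι a * H a - ι a
    ≡⟨ solve 2 (λ A h → A :* h :- A := A :* (h :- con 1ℚ)) refl (ι a) (H a) ⟩
  ι a * (H a - 1ℚ) ∎
  where
  open ℚ.≤-Reasoning
  a = suc (b ℕ.+ r)
  v = 1/[1+ b ℕ.+ r ]
  v*a≡1 : v * ι a ≡ 1ℚ
  v*a≡1 = 1/[1+n]*ι[1+n]≡1 (b ℕ.+ r)
... | no a≰N = begin
  ι a * (H b - 1ℚ) + ι (suc r)  ≤⟨ ℚ.+-monoʳ-≤ (ι a * (H b - 1ℚ)) (ι-mono-≤ (s≤s (ℕ.m≤n+m r b))) ⟩
  ι a * (H b - 1ℚ) + ι a        ≡⟨ solve 2 (λ A h → A :* (h :- con 1ℚ) :+ A := A :* h) refl (ι a) (H b) ⟩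
  ι a * H b                     ≤⟨ *-monoˡ-≤-0≤ (0≤ι a) (H-mono-≤ b≤N) ⟩
  ι a * H N                     ∎
  where
  open ℚ.≤-Reasoning
  a = suc (b ℕ.+ r)

ι*-cancelˡ-≤ : ∀ {a x y} → 0 ℕ.< a → ι a * x ≤ ι a * y → x ≤ y
ι*-cancelˡ-≤ {suc a} _ = ℚ.*-cancelˡ-≤-pos (ι (suc a)) {{ℚ.normalize-pos (suc a) 1}}

x-y+z≤x : ∀ x {y z} → z ≤ y → x - y + z ≤ x
x-y+z≤x x {y} {z} z≤y = subst (_≤ x) (solve 3 (λ x y z → x :- (y :- z) := x :- y :+ z) refl x y z) (x-y≤x x (x≤y⇒0≤y-x z≤y))

x-y≤0⇒x≤y : ∀ {x y} → x - y ≤ 0ℚ → x ≤ y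
x-y≤0⇒x≤y {x} {y} x-y≤0 =
  subst₂ _≤_ (solve 2 (λ x y → x :- y :+ y := x) refl x y) (ℚ.+-identityˡ y) (ℚ.+-monoˡ-≤ y x-y≤0)

ι*x≤ι*[x+potential] : ∀ N {a x} → 0 ℕ.< a → ι a * x ≤ ι a * (x + potential N a)
ι*x≤ι*[x+potential] N {a} {x} 0<a = *-monoˡ-≤-0≤ (0≤ι a) (x≤x+y x (0≤potential N 0<a))

potential-merge : ∀ N b r e {S₁ S₂} → 1 ℕ.≤ b → b ℕ.≤ N ⊎ r ≡ 0 →
                  S₁ ≤ ι b * (e + potential N b) → S₂ ≤ ι r * (e + 1ℚ + potential N b) →
                  S₁ + S₂ ≤ ι (b ℕ.+ r) * (e + potential N (b ℕ.+ r))
potential-merge N b r e {S₁} {S₂} 1≤b b≤N⊎r≡0 S₁≤ S₂≤ = begin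
  S₁ + S₂                                        ≤⟨ ℚ.+-mono-≤ S₁≤ S₂≤ ⟩
  ι b * (e + φb) + ι r * (e + 1ℚ + φb)           ≡⟨ solve 4 (λ B R e f → B :* (e :+ f) :+ R :* (e :+ con 1ℚ :+ f)
                                                                := (B :+ R) :* e :+ ((B :+ R) :* f :+ R)) refl (ι b) (ι r) e φb ⟩
  (ι b + ι r) * e + ((ι b + ι r) * φb + ι r)     ≡⟨ cong (λ a → a * e + (a * φb + ι r)) (sym (ι-+ b r)) ⟩
  ι a * e + (ι a * φb + ι r)                     ≤⟨ ℚ.+-monoʳ-≤ (ι a * e) (potential-growth N b r 1≤b b≤N⊎r≡0) ⟩
  ι a * e + ι a * potential N a                  ≡⟨ sym (ℚ.*-distribˡ-+ (ι a) e (potential N a)) ⟩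
  ι a * (e + potential N a)                      ∎
  where
  open ℚ.≤-Reasoning
  a = b ℕ.+ r
  φb = potential N b

private
  variable
    A B A′ B′ : Set

𝔼ℚ : Dist A → (A → ℚ) → ℚ
𝔼ℚ [] F = 0ℚ
𝔼ℚ ((w , a) ∷ d) F = w * F a + 𝔼ℚ d F

mass : Dist A → ℚ
mass d = 𝔼ℚ d (λ _ → 1ℚ)

𝔼≡𝔼ℚ : ∀ (d : Dist A) f → 𝔼 d f ≡ 𝔼ℚ d (λ a → ι (f a))
𝔼≡𝔼ℚ [] f = refl
𝔼≡𝔼ℚ ((w , a) ∷ d) f = cong (w * ι (f a) +_) (𝔼≡𝔼ℚ d f)

𝔼ℚ-cong : ∀ (d : Dist A) {F G : A → ℚ} → (∀ a → F a ≡ G a) → 𝔼ℚ d F ≡ 𝔼ℚ d G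
𝔼ℚ-cong [] F≗G = refl
𝔼ℚ-cong ((w , a) ∷ d) F≗G = cong₂ (λ x y → w * x + y) (F≗G a) (𝔼ℚ-cong d F≗G)

𝔼ℚ-return : ∀ (a : A) F → 𝔼ℚ (return a) F ≡ F a
𝔼ℚ-return a F = trans (ℚ.+-identityʳ (1ℚ * F a)) (ℚ.*-identityˡ (F a))

𝔼ℚ-++ : ∀ (d e : Dist A) F → 𝔼ℚ (d ++ e) F ≡ 𝔼ℚ d F + 𝔼ℚ e F
𝔼ℚ-++ [] e F = sym (ℚ.+-identityˡ _)
𝔼ℚ-++ ((w , a) ∷ d) e F =
  trans (cong (w * F a +_) (𝔼ℚ-++ d e F)) (sym (ℚ.+-assoc (w * F a) (𝔼ℚ d F) (𝔼ℚ e F)))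

scale : ℚ → Dist A → Dist A
scale w = map (λ { (w′ , a) → (w * w′ , a) })

𝔼ℚ-scale : ∀ w (d : Dist A) F → 𝔼ℚ (scale w d) F ≡ w * 𝔼ℚ d F
𝔼ℚ-scale w [] F = sym (ℚ.*-zeroʳ w)
𝔼ℚ-scale w ((w′ , a) ∷ d) F =
  trans (cong₂ _+_ (ℚ.*-assoc w w′ (F a)) (𝔼ℚ-scale w d F))
        (sym (ℚ.*-distribˡ-+ w (w′ * F a) (𝔼ℚ d F)))

𝔼ℚ-bind : ∀ (d : Dist A) (f : A → Dist B) F → 𝔼ℚ (d >>= f) F ≡ 𝔼ℚ d (λ a → 𝔼ℚ (f a) F)
𝔼ℚ-bind [] f F = refl
𝔼ℚ-bind ((w , a) ∷ d) f F =
  trans (𝔼ℚ-++ (scale w (f a)) (d >>= f) F) (cong₂ _+_ (𝔼ℚ-scale w (f a) F) (𝔼ℚ-bind d f F))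

𝔼ℚ-+ : ∀ (d : Dist A) F G → 𝔼ℚ d (λ a → F a + G a) ≡ 𝔼ℚ d F + 𝔼ℚ d G
𝔼ℚ-+ [] F G = refl
𝔼ℚ-+ ((w , a) ∷ d) F G =
  trans (cong₂ _+_ (ℚ.*-distribˡ-+ w (F a) (G a)) (𝔼ℚ-+ d F G))
        (solve 4 (λ x y z u → (x :+ y) :+ (z :+ u) := (x :+ z) :+ (y :+ u)) refl
               (w * F a) (w * G a) (𝔼ℚ d F) (𝔼ℚ d G))

𝔼ℚ-* : ∀ (d : Dist A) c F → 𝔼ℚ d (λ a → c * F a) ≡ c * 𝔼ℚ d F
𝔼ℚ-* [] c F = sym (ℚ.*-zeroʳ c)
𝔼ℚ-* ((w , a) ∷ d) c F =
  trans (cong₂ _+_ (solve 3 (λ w c x → w :* (c :* x) := c :* (w :* x)) refl w c (F a)) (𝔼ℚ-* d c F))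
        (sym (ℚ.*-distribˡ-+ c (w * F a) (𝔼ℚ d F)))

𝔼ℚ-linear : ∀ (d : Dist A) F c G → 𝔼ℚ d (λ a → F a - c * G a) ≡ 𝔼ℚ d F - c * 𝔼ℚ d G
𝔼ℚ-linear [] F c G = solve 1 (λ c → con 0ℚ := con 0ℚ :- c :* con 0ℚ) refl c
𝔼ℚ-linear ((w , a) ∷ d) F c G =
  trans (cong (w * (F a - c * G a) +_) (𝔼ℚ-linear d F c G))
        (solve 6 (λ w f c g x y → w :* (f :- c :* g) :+ (x :- c :* y) := (w :* f :+ x) :- c :* (w :* g :+ y)) refl
               w (F a) c (G a) (𝔼ℚ d F) (𝔼ℚ d G))

𝔼ℚ-const : ∀ (d : Dist A) c → 𝔼ℚ d (λ _ → c) ≡ c * mass d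
𝔼ℚ-const d c = trans (𝔼ℚ-cong d (λ _ → sym (ℚ.*-identityʳ c))) (𝔼ℚ-* d c (λ _ → 1ℚ))

𝔼ℚ-0 : ∀ (d : Dist A) → 𝔼ℚ d (λ _ → 0ℚ) ≡ 0ℚ
𝔼ℚ-0 d = trans (𝔼ℚ-const d 0ℚ) (ℚ.*-zeroˡ (mass d))

mass-bind : ∀ (d : Dist A) (f : A → Dist B) → mass d ≡ 1ℚ → (∀ a → mass (f a) ≡ 1ℚ) →
            mass (d >>= f) ≡ 1ℚ
mass-bind d f d≡1 f≡1 = trans (𝔼ℚ-bind d f (λ _ → 1ℚ)) (trans (𝔼ℚ-cong d f≡1) d≡1)

-- Dist does not force weights to be nonnegative, so Surely records it alongside P.
Surely : (A → Set) → Dist A → Set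
Surely P d = All (λ { (w , a) → 0ℚ ≤ w × P a }) d

module _ {P Q : A → Set} where

  Surely-map : (∀ {a} → P a → Q a) → ∀ {d} → Surely P d → Surely Q d
  Surely-map P⇒Q [] = []
  Surely-map P⇒Q ((0≤w , pa) ∷ s) = (0≤w , P⇒Q pa) ∷ Surely-map P⇒Q s

  Surely-zip : ∀ {d} → Surely P d → Surely Q d → Surely (λ a → P a × Q a) d
  Surely-zip [] [] = []
  Surely-zip ((0≤w , pa) ∷ s) ((_ , qa) ∷ t) = (0≤w , pa , qa) ∷ Surely-zip s t

Surely-return : ∀ {P : A → Set} {a} → P a → Surely P (return a)
Surely-return pa = (ℚ.nonNegative⁻¹ 1ℚ , pa) ∷ []

Surely-bind : ∀ {P : A → Set} {Q : B → Set} (d : Dist A) (f : A → Dist B) →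
              Surely P d → (∀ a → P a → Surely Q (f a)) → Surely Q (d >>= f)
Surely-bind [] f [] Pf = []
Surely-bind ((w , a) ∷ d) f ((0≤w , pa) ∷ s) Pf = All.++⁺ (scale⁺ (f a) (Pf a pa)) (Surely-bind d f s Pf)
  where
  scale⁺ : ∀ e → Surely _ e → Surely _ (scale w e)
  scale⁺ [] [] = []
  scale⁺ (_ ∷ e) ((0≤w′ , qb) ∷ t) = (0≤x*y 0≤w 0≤w′ , qb) ∷ scale⁺ e t

𝔼ℚ-mono : ∀ (d : Dist A) {F G} → Surely (λ a → F a ≤ G a) d → 𝔼ℚ d F ≤ 𝔼ℚ d G
𝔼ℚ-mono [] [] = ℚ.≤-refl
𝔼ℚ-mono ((w , a) ∷ d) ((0≤w , Fa≤Ga) ∷ s) = ℚ.+-mono-≤ (*-monoˡ-≤-0≤ 0≤w Fa≤Ga) (𝔼ℚ-mono d s)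

𝔼ℚ-congˢ : ∀ (d : Dist A) {F G} → Surely (λ a → F a ≡ G a) d → 𝔼ℚ d F ≡ 𝔼ℚ d G
𝔼ℚ-congˢ [] [] = refl
𝔼ℚ-congˢ ((w , a) ∷ d) ((_ , Fa≡Ga) ∷ s) = cong₂ (λ x y → w * x + y) Fa≡Ga (𝔼ℚ-congˢ d s)

𝔼ℚ-const₁ : ∀ (d : Dist A) {c} → mass d ≡ 1ℚ → 𝔼ℚ d (λ _ → c) ≡ c
𝔼ℚ-const₁ d {c} d≡1 = trans (𝔼ℚ-const d c) (trans (cong (c *_) d≡1) (ℚ.*-identityʳ c))

𝔼ℚ-constˢ : ∀ (d : Dist A) {F c} → mass d ≡ 1ℚ → Surely (λ a → F a ≡ c) d → 𝔼ℚ d F ≡ c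
𝔼ℚ-constˢ d d≡1 s = trans (𝔼ℚ-congˢ d s) (𝔼ℚ-const₁ d d≡1)

data Coupled (R : A → B → Set) : Dist A → Dist B → Set where
  []  : Coupled R [] []
  _∷_ : ∀ {w a b d e} → R a b → Coupled R d e → Coupled R ((w , a) ∷ d) ((w , b) ∷ e)

Coupled-𝔼ℚ : ∀ {R : A → B → Set} {d e} {F : A → ℚ} {G : B → ℚ} →
             (∀ {a b} → R a b → F a ≡ G b) → Coupled R d e → 𝔼ℚ d F ≡ 𝔼ℚ e G
Coupled-𝔼ℚ F≡G [] = refl
Coupled-𝔼ℚ {d = (w , _) ∷ _} F≡G (r ∷ rs) = cong₂ (λ x y → w * x + y) (F≡G r) (Coupled-𝔼ℚ F≡G rs)

Coupled-return : ∀ {R : A → B → Set} {a b} → R a b → Coupled R (return a) (return b)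
Coupled-return r = r ∷ []

Coupled-refl : ∀ (d : Dist A) → Coupled _≡_ d d
Coupled-refl [] = []
Coupled-refl (_ ∷ d) = refl ∷ Coupled-refl d

Coupled-bind : ∀ {R : A → B → Set} {S : A′ → B′ → Set} {d e} (f : A → Dist A′) (g : B → Dist B′) →
               Coupled R d e → (∀ {a b} → R a b → Coupled S (f a) (g b)) → Coupled S (d >>= f) (e >>= g)
Coupled-bind f g [] fSg = []
Coupled-bind {S = S} {d = (w , a) ∷ _} {e = (_ , b) ∷ _} f g (r ∷ rs) fSg =
  ++⁺ (scale⁺ (fSg r)) (Coupled-bind f g rs fSg)
  where
  ++⁺ : ∀ {d d′ e e′} → Coupled S d e → Coupled S d′ e′ → Coupled S (d ++ d′) (e ++ e′)
  ++⁺ [] c′ = c′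
  ++⁺ (s ∷ c) c′ = s ∷ ++⁺ c c′
  scale⁺ : ∀ {d e} → Coupled S d e → Coupled S (scale w d) (scale w e)
  scale⁺ [] = []
  scale⁺ (s ∷ c) = s ∷ scale⁺ c

∑ : List A → (A → ℚ) → ℚ
∑ [] F = 0ℚ
∑ (x ∷ xs) F = F x + ∑ xs F

∑-congᴬ : ∀ {xs : List A} {F G} → All (λ x → F x ≡ G x) xs → ∑ xs F ≡ ∑ xs G
∑-congᴬ [] = refl
∑-congᴬ (Fx≡Gx ∷ eqs) = cong₂ _+_ Fx≡Gx (∑-congᴬ eqs)

∑-cong : ∀ (xs : List A) {F G} → (∀ x → F x ≡ G x) → ∑ xs F ≡ ∑ xs G
∑-cong xs F≗G = ∑-congᴬ (All.universal F≗G xs)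

∑-monoᴬ : ∀ {xs : List A} {F G} → All (λ x → F x ≤ G x) xs → ∑ xs F ≤ ∑ xs G
∑-monoᴬ [] = ℚ.≤-refl
∑-monoᴬ (Fx≤Gx ∷ les) = ℚ.+-mono-≤ Fx≤Gx (∑-monoᴬ les)

∑-const : ∀ (xs : List A) c → ∑ xs (λ _ → c) ≡ ι (length xs) * c
∑-const [] c = sym (ℚ.*-zeroˡ c)
∑-const (x ∷ xs) c = begin
  c + ∑ xs (λ _ → c)        ≡⟨ cong (c +_) (∑-const xs c) ⟩
  c + ι (length xs) * c     ≡⟨ solve 2 (λ c n → c :+ n :* c := (con 1ℚ :+ n) :* c) refl c (ι (length xs)) ⟩
  (1ℚ + ι (length xs)) * c  ≡⟨ cong (_* c) (sym (ι-suc (length xs))) ⟩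
  ι (suc (length xs)) * c   ∎
  where open ≡-Reasoning

∑-𝔼ℚ : ∀ (xs : List A) (d : Dist B) (F : A → B → ℚ) →
       ∑ xs (λ x → 𝔼ℚ d (F x)) ≡ 𝔼ℚ d (λ b → ∑ xs (λ x → F x b))
∑-𝔼ℚ [] d F = sym (𝔼ℚ-0 d)
∑-𝔼ℚ (x ∷ xs) d F = trans (cong (𝔼ℚ d (F x) +_) (∑-𝔼ℚ xs d F)) (sym (𝔼ℚ-+ d (F x) _))

module _ {P : A → Set} (P? : Decidable P) where

  ∑-partition : ∀ xs F → ∑ xs F ≡ ∑ (filter P? xs) F + ∑ (filter (∁? P?) xs) F
  ∑-partition [] F = sym (ℚ.+-identityʳ 0ℚ)
  ∑-partition (x ∷ xs) F with does (P? x)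
  ... | true  = trans (cong (F x +_) (∑-partition xs F)) (sym (ℚ.+-assoc (F x) _ _))
  ... | false = trans (cong (F x +_) (∑-partition xs F))
                  (solve 3 (λ a s t → a :+ (s :+ t) := s :+ (a :+ t)) refl
                         (F x) (∑ (filter P? xs) F) (∑ (filter (∁? P?) xs) F))

  length-partition : ∀ xs → length xs ≡ length (filter P? xs) ℕ.+ length (filter (∁? P?) xs)
  length-partition [] = refl
  length-partition (x ∷ xs) with does (P? x)
  ... | true  = cong suc (length-partition xs)
  ... | false = trans (cong suc (length-partition xs)) (sym (ℕ.+-suc _ _))

filter-⊆ : ∀ {P Q : A → Set} (P? : Decidable P) (Q? : Decidable Q) → (∀ {x} → P x → Q x) →
           ∀ xs → filter P? (filter Q? xs) ≡ filter P? xs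
filter-⊆ P? Q? P⇒Q [] = refl
filter-⊆ {P = P} {Q} P? Q? P⇒Q (x ∷ xs) = cases (Q? x) (P? x)
  where
  open ≡-Reasoning
  IH = filter-⊆ P? Q? P⇒Q xs
  cases : Dec (Q x) → Dec (P x) → filter P? (filter Q? (x ∷ xs)) ≡ filter P? (x ∷ xs)
  cases (yes q) (yes p) = begin
    filter P? (filter Q? (x ∷ xs))  ≡⟨ cong (filter P?) (filter-accept Q? q) ⟩
    filter P? (x ∷ filter Q? xs)    ≡⟨ filter-accept P? p ⟩
    x ∷ filter P? (filter Q? xs)    ≡⟨ cong (x ∷_) IH ⟩
    x ∷ filter P? xs                ≡⟨ filter-accept P? p ⟨
    filter P? (x ∷ xs)              ∎
  cases (yes q) (no ¬p) = begin
    filter P? (filter Q? (x ∷ xs))  ≡⟨ cong (filter P?) (filter-accept Q? q) ⟩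
    filter P? (x ∷ filter Q? xs)    ≡⟨ filter-reject P? ¬p ⟩
    filter P? (filter Q? xs)        ≡⟨ IH ⟩
    filter P? xs                    ≡⟨ filter-reject P? ¬p ⟨
    filter P? (x ∷ xs)              ∎
  cases (no ¬q) _ = begin
    filter P? (filter Q? (x ∷ xs))  ≡⟨ cong (filter P?) (filter-reject Q? ¬q) ⟩
    filter P? (filter Q? xs)        ≡⟨ IH ⟩
    filter P? xs                    ≡⟨ filter-reject P? (¬q ∘ P⇒Q) ⟨
    filter P? (x ∷ xs)              ∎

𝔼ℚ-weighted : ∀ w (xs : List A) F → 𝔼ℚ (map (λ x → (w , x)) xs) F ≡ w * ∑ xs F
𝔼ℚ-weighted w [] F = sym (ℚ.*-zeroʳ w)
𝔼ℚ-weighted w (x ∷ xs) F =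
  trans (cong (w * F x +_) (𝔼ℚ-weighted w xs F)) (sym (ℚ.*-distribˡ-+ w (F x) (∑ xs F)))

ι*𝔼ℚ-uniformOr : ∀ (o : A) xs F → 0 ℕ.< length xs → ι (length xs) * 𝔼ℚ (uniformOr o xs) F ≡ ∑ xs F
ι*𝔼ℚ-uniformOr o (x ∷ xs) F _ = begin
  ι n * 𝔼ℚ (uniformOr o (x ∷ xs)) F  ≡⟨ cong (ι n *_) (𝔼ℚ-weighted 1/[1+ length xs ] (x ∷ xs) F) ⟩
  ι n * (1/[1+ length xs ] * S)      ≡⟨ sym (ℚ.*-assoc (ι n) _ S) ⟩
  (ι n * 1/[1+ length xs ]) * S      ≡⟨ cong (_* S) (trans (ℚ.*-comm (ι n) _) (1/[1+n]*ι[1+n]≡1 (length xs))) ⟩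
  1ℚ * S                             ≡⟨ ℚ.*-identityˡ S ⟩
  S                                  ∎
  where
  open ≡-Reasoning
  n = length (x ∷ xs)
  S = ∑ (x ∷ xs) F

mass-uniformOr : ∀ (o : A) xs → mass (uniformOr o xs) ≡ 1ℚ
mass-uniformOr o [] = 𝔼ℚ-return o (λ _ → 1ℚ)
mass-uniformOr o (x ∷ xs) = begin
  mass (uniformOr o (x ∷ xs))                 ≡⟨ 𝔼ℚ-weighted 1/[1+ length xs ] (x ∷ xs) (λ _ → 1ℚ) ⟩
  1/[1+ length xs ] * ∑ (x ∷ xs) (λ _ → 1ℚ)   ≡⟨ cong (1/[1+ length xs ] *_) (trans (∑-const (x ∷ xs) 1ℚ) (ℚ.*-identityʳ _)) ⟩
  1/[1+ length xs ] * ι (suc (length xs))     ≡⟨ 1/[1+n]*ι[1+n]≡1 (length xs) ⟩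
  1ℚ                                          ∎
  where open ≡-Reasoning

Surely-uniformOr : ∀ {P : A → Set} o xs → (xs ≡ [] → P o) → All P xs → Surely P (uniformOr o xs)
Surely-uniformOr o [] P[o] [] = Surely-return (P[o] refl)
Surely-uniformOr {P = P} o (x ∷ xs) _ Pxs = go (x ∷ xs) Pxs
  where
  go : ∀ ys → All P ys → Surely P (map (λ y → (1/[1+ length xs ] , y)) ys)
  go [] [] = []
  go (y ∷ ys) (Py ∷ Pys) = (0≤1/[1+n] (length xs) , Py) ∷ go ys Pys

mass-uniformOr-map : ∀ (o : A) xs (g : A → B) → mass (uniformOr o xs >>= λ x → return (g x)) ≡ 1ℚ
mass-uniformOr-map o xs g = mass-bind (uniformOr o xs) (λ x → return (g x)) (mass-uniformOr o xs) (λ x → 𝔼ℚ-return (g x) _)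

Coupled-uniformOr-map : ∀ {R : B → B′ → Set} {o o′ : A} {xs xs′} (g : A → B) (g′ : A → B′) →
                        o ≡ o′ → xs ≡ xs′ → (∀ x → R (g x) (g′ x)) →
                        Coupled R (uniformOr o xs >>= λ x → return (g x)) (uniformOr o′ xs′ >>= λ x → return (g′ x))
Coupled-uniformOr-map {o = o} {xs = xs} g g′ refl refl gRg′ =
  Coupled-bind _ _ (Coupled-refl (uniformOr o xs)) (λ { {x} refl → Coupled-return (gRg′ x) })

𝔼ℚ-uniformOr-map : ∀ (o : A) xs (g : A → B) F →
                   𝔼ℚ (uniformOr o xs >>= λ x → return (g x)) F ≡ 𝔼ℚ (uniformOr o xs) (λ x → F (g x))
𝔼ℚ-uniformOr-map o xs g F =
  trans (𝔼ℚ-bind (uniformOr o xs) (λ x → return (g x)) F) (𝔼ℚ-cong (uniformOr o xs) (λ x → 𝔼ℚ-return (g x) F))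

<⇒<ᵇ≡true : ∀ {a b} → a ℕ.< b → (a <ᵇ b) ≡ true
<⇒<ᵇ≡true = Equivalence.to T-≡ ∘ ℕ.<⇒<ᵇ

<ᵇ≡true⇒< : ∀ {a b} → (a <ᵇ b) ≡ true → a ℕ.< b
<ᵇ≡true⇒< {a} {b} = ℕ.<ᵇ⇒< a b ∘ Equivalence.from T-≡

≤⇒<ᵇ≡false : ∀ {a b} → b ℕ.≤ a → (a <ᵇ b) ≡ false
≤⇒<ᵇ≡false {a} {b} b≤a with a <ᵇ b in eq
... | false = refl
... | true  = ⊥-elim (ℕ.<⇒≱ (<ᵇ≡true⇒< eq) b≤a)

<ᵇ≡false⇒≤ : ∀ {a b} → (a <ᵇ b) ≡ false → b ℕ.≤ a
<ᵇ≡false⇒≤ a<ᵇb≡false = ℕ.≮⇒≥ (λ a<b → case trans (sym (<⇒<ᵇ≡true a<b)) a<ᵇb≡false of λ ())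

snoc-inject₁ : ∀ {A : Set} {s} (f : Fin s → A) a r → snoc f a (inject₁ r) ≡ f r
snoc-inject₁ {s = suc s} f a zero    = refl
snoc-inject₁ {s = suc s} f a (suc r) = snoc-inject₁ (f ∘ suc) a r

snoc-last : ∀ {A : Set} {s} (f : Fin s → A) a → snoc f a (fromℕ s) ≡ a
snoc-last {s = zero}  f a = refl
snoc-last {s = suc s} f a = snoc-last (f ∘ suc) a

snoc-⇒ : ∀ {s} (f g : Fin s → Bool) {a b} → (∀ r → f r ≡ true → g r ≡ true) → (a ≡ true → b ≡ true) →
         ∀ r → snoc f a r ≡ true → snoc g b r ≡ true
snoc-⇒ {zero}  f g f⇒g a⇒b zero    = a⇒b
snoc-⇒ {suc s} f g f⇒g a⇒b zero    = f⇒g zero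
snoc-⇒ {suc s} f g f⇒g a⇒b (suc r) = snoc-⇒ (f ∘ suc) (g ∘ suc) (f⇒g ∘ suc) a⇒b r

module _ {k : ℕ} where

  HSP-extend : ∀ {n} {P : Pattern k (suc n)} ℓt → HSP P → HSP (extend P ℓt)
  HSP-extend {P = P} ℓt (starts , refines) = starts′ , refines′
    where
    starts′ : ∀ i r → toℕ r ≡ 0 → extend P ℓt i r ≡ true
    starts′ i zero _ = starts i zero refl
    refines′ : ∀ i j r → toℕ i ℕ.≤ toℕ j → extend P ℓt j r ≡ true → extend P ℓt i r ≡ true
    refines′ i j r i≤j = snoc-⇒ (P j) (P i) (λ r → refines i j r i≤j)
      (λ j<ℓt → <⇒<ᵇ≡true (ℕ.≤-<-trans i≤j (<ᵇ≡true⇒< {toℕ j} {toℕ ℓt} j<ℓt))) r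

  HSP-first : HSP (extend (emptyPattern k) (fromℕ k))
  HSP-first = starts , refines
    where
    i<k : ∀ (i : Fin k) → (toℕ i <ᵇ toℕ (fromℕ k)) ≡ true
    i<k i = <⇒<ᵇ≡true (subst (toℕ i ℕ.<_) (sym (Fin.toℕ-fromℕ k)) (Fin.toℕ<n i))
    starts : ∀ i r → toℕ r ≡ 0 → extend (emptyPattern k) (fromℕ k) i r ≡ true
    starts i zero _ = i<k i
    refines : ∀ i j r → toℕ i ℕ.≤ toℕ j → extend (emptyPattern k) (fromℕ k) j r ≡ true →
              extend (emptyPattern k) (fromℕ k) i r ≡ true
    refines i j zero _ _ = i<k i

module _ {k n m : ℕ} (P : Pattern k (suc n)) (ρ : Fin (suc n) → Fin m) where

  InQ-cong : ∀ i {p p′ : Fin k → Fin m} {q} → (∀ j → toℕ i ℕ.< toℕ j → p j ≡ p′ j) →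
             InQ P ρ i p q → InQ P ρ i p′ q
  InQ-cong i p≡p′ (γ , lab , feas , last , above) = γ , lab , feas , last , λ j i<j → trans (above j i<j) (p≡p′ j i<j)

  Qlist-cong : ∀ i {p p′ : Fin k → Fin m} → (∀ j → toℕ i ℕ.< toℕ j → p j ≡ p′ j) → Qlist P ρ i p ≡ Qlist P ρ i p′
  Qlist-cong i p≡p′ = filter-≐ (InQ? P ρ i _) (InQ? P ρ i _)
    (InQ-cong i p≡p′ , InQ-cong i (λ j i<j → sym (p≡p′ j i<j))) (allFin m)

  All-InQ-Qlist : ∀ i p → All (InQ P ρ i p) (Qlist P ρ i p)
  All-InQ-Qlist i p = all-filter (InQ? P ρ i p) (allFin m)

  0<length-Qlist : ∀ {i p q} → InQ P ρ i p q → 0 ℕ.< length (Qlist P ρ i p)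
  0<length-Qlist {i} {p} {q} q∈Q = filter-some (InQ? P ρ i p) (lose (∈-allFin q) q∈Q)

  -- The labeling witnessing p y ∈ Q at level y also witnesses its own label at level x.
  InQ-lower : ∀ {x y} p → toℕ y ≡ suc (toℕ x) → InQ P ρ y p (p y) → ∃ (InQ P ρ x p)
  InQ-lower {x} {y} p y≡1+x (γ , lab , feas , last , above) = γ x (fromℕ n) , γ , lab , feas , refl , above′
    where
    above′ : ∀ i → toℕ x ℕ.< toℕ i → γ i (fromℕ n) ≡ p i
    above′ i x<i with toℕ i ℕ.≟ toℕ y
    ... | yes i≡y rewrite Fin.toℕ-injective i≡y = last
    ... | no  i≢y = above i (subst (ℕ._< toℕ i) (sym y≡1+x) (ℕ.≤∧≢⇒< x<i 1+x≢i))
      where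
      1+x≢i : suc (toℕ x) ≢ toℕ i
      1+x≢i 1+x≡i = i≢y (trans (sym 1+x≡i) (sym y≡1+x))

  InQ-top : ∀ {x} p → suc (toℕ x) ≡ k → HasFeasibleLabeling P ρ → ∃ (InQ P ρ x p)
  InQ-top {x} p 1+x≡k (γ , lab , feas) = γ x (fromℕ n) , γ , lab , feas , refl ,
    λ i x<i → ⊥-elim (ℕ.<⇒≱ (Fin.toℕ<n i) (subst (ℕ._≤ toℕ i) 1+x≡k x<i))

  -- When ℓt ≤ ℓ the last intervals of the levels ≥ ℓ are merely prolonged by the extension.
  InQ-restrict : ∀ σ ℓt ℓ {p q} → toℕ ℓt ℕ.≤ toℕ ℓ → InQ (extend P ℓt) (snoc ρ σ) ℓ p q → InQ P ρ ℓ p q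
  InQ-restrict σ ℓt ℓ {p} {q} ℓt≤ℓ (γ , lab , feas , last , above) = γ′ , lab′ , feas′ , last′ , above′
    where
    γ′ : Fin k → Fin (suc n) → Fin m
    γ′ i r = γ i (inject₁ r)
    lab′ : IsLabeling P γ′
    lab′ i r r′ r′≡1+r fresh = lab i (inject₁ r) (inject₁ r′)
      (trans (Fin.toℕ-inject₁ r′) (trans r′≡1+r (cong suc (sym (Fin.toℕ-inject₁ r)))))
      (trans (snoc-inject₁ (P i) _ r′) fresh)
    feas′ : Feasible ρ γ′
    feas′ r = proj₁ (feas (inject₁ r)) , trans (proj₂ (feas (inject₁ r))) (snoc-inject₁ ρ σ r)
    prolonged : ∀ i → toℕ ℓ ℕ.≤ toℕ i → γ i (fromℕ (suc n)) ≡ γ′ i (fromℕ n)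
    prolonged i ℓ≤i = lab i (inject₁ (fromℕ n)) (fromℕ (suc n))
      (cong suc (trans (Fin.toℕ-fromℕ n) (sym (trans (Fin.toℕ-inject₁ (fromℕ n)) (Fin.toℕ-fromℕ n)))))
      (trans (snoc-last (P i) _) (≤⇒<ᵇ≡false (ℕ.≤-trans ℓt≤ℓ ℓ≤i)))
    last′ : γ′ ℓ (fromℕ n) ≡ q
    last′ = trans (sym (prolonged ℓ ℕ.≤-refl)) last
    above′ : ∀ i → toℕ ℓ ℕ.< toℕ i → γ′ i (fromℕ n) ≡ p i
    above′ i ℓ<i = trans (sym (prolonged i (ℕ.<⇒≤ ℓ<i))) (above i ℓ<i)

  InQ-cong-self : ∀ i {p p′ : Fin k → Fin m} → (∀ j → toℕ i ℕ.≤ toℕ j → p j ≡ p′ j) →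
                  InQ P ρ i p (p i) → InQ P ρ i p′ (p′ i)
  InQ-cong-self i p≡p′ = subst (InQ P ρ i _) (p≡p′ i ℕ.≤-refl) ∘ InQ-cong i (λ j i<j → p≡p′ j (ℕ.<⇒≤ i<j))

data LevelsAbove {k : ℕ} (x : Fin k) : List (Fin k) → Set where
  top  : suc (toℕ x) ≡ k → LevelsAbove x []
  next : ∀ {y ys} → toℕ y ≡ suc (toℕ x) → LevelsAbove y ys → LevelsAbove x (y ∷ ys)

LevelsAbove-suc : ∀ {k} {x : Fin k} {ys} → LevelsAbove x ys → LevelsAbove (suc x) (map suc ys)
LevelsAbove-suc (top 1+x≡k) = top (cong suc 1+x≡k)
LevelsAbove-suc (next y≡1+x above) = next (cong suc y≡1+x) (LevelsAbove-suc above)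

allFin-suc : ∀ k → allFin (suc k) ≡ zero ∷ map suc (allFin k)
allFin-suc k = cong (zero ∷_) (sym (map-tabulate id suc))

LevelsAbove-zero : ∀ k → LevelsAbove {suc k} zero (map suc (allFin k))
LevelsAbove-zero zero = top refl
LevelsAbove-zero (suc k) =
  next refl (subst (λ zs → LevelsAbove (suc zero) (map suc zs)) (map-tabulate id suc) (LevelsAbove-suc (LevelsAbove-zero k)))

LevelsAbove⇒All> : ∀ {k} {x : Fin k} {ys} → LevelsAbove x ys → All (λ y → toℕ x ℕ.< toℕ y) ys
LevelsAbove⇒All> (top _) = []
LevelsAbove⇒All> {x = x} (next {y} y≡1+x above) =
  x<y ∷ All.map (ℕ.<-trans x<y) (LevelsAbove⇒All> above)
  where
  x<y : toℕ x ℕ.< toℕ y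
  x<y = ℕ.≤-reflexive (sym y≡1+x)

allFin-split : ∀ k (ℓ : Fin k) → ∃₂ λ xs ys →
               allFin k ≡ xs ++ ℓ ∷ ys × All (λ x → toℕ x ℕ.< toℕ ℓ) xs × LevelsAbove ℓ ys
allFin-split (suc k) zero = [] , map suc (allFin k) , allFin-suc k , [] , LevelsAbove-zero k
allFin-split (suc k) (suc ℓ) with allFin-split k ℓ
... | xs , ys , allFin≡ , below , above =
  zero ∷ map suc xs , map suc ys ,
  trans (allFin-suc k) (cong (zero ∷_) (trans (cong (map suc) allFin≡) (map-++ suc xs (ℓ ∷ ys)))) ,
  s≤s z≤n ∷ All.map s≤s (All.map⁺ below) , LevelsAbove-suc above

private
  variable
    m k n : ℕ

State : ℕ → ℕ → Set
State m k = Config m k × Bool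

module _ (P : Pattern k (suc n)) (ρ : Fin (suc n) → Fin m) (ℓt : Fin (suc k)) where

  -- Like round, steps serves the levels in zs starting from the last one.
  steps : List (Fin k) → Dist (State m k) → Dist (State m k)
  steps zs d = foldr (λ i d → d >>= λ st → step P ρ ℓt st i) d zs

  𝔼ℚ-round : ∀ c F → 𝔼ℚ (round P ρ ℓt c) F ≡ 𝔼ℚ (steps (allFin k) (return (c , false))) (F ∘ proj₁)
  𝔼ℚ-round c F = begin
    𝔼ℚ (round P ρ ℓt c) F
      ≡⟨ 𝔼ℚ-bind byFoldl (λ st → return (proj₁ st)) F ⟩
    𝔼ℚ byFoldl (λ st → 𝔼ℚ (return (proj₁ st)) F)
      ≡⟨ 𝔼ℚ-cong byFoldl (λ st → 𝔼ℚ-return (proj₁ st) F) ⟩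
    𝔼ℚ byFoldl (F ∘ proj₁)
      ≡⟨ cong (λ d → 𝔼ℚ d (F ∘ proj₁)) (reverse-foldl _ (return (c , false)) (allFin k)) ⟩
    𝔼ℚ (steps (allFin k) (return (c , false))) (F ∘ proj₁) ∎
    where
    open ≡-Reasoning
    byFoldl = foldl (λ d i → d >>= λ st → step P ρ ℓt st i) (return (c , false)) (reverse (allFin k))

  steps-++ : ∀ xs ys d → steps (xs ++ ys) d ≡ steps xs (steps ys d)
  steps-++ xs ys d = foldr-++ _ d xs ys

  𝔼ℚ-steps : ∀ zs d F → 𝔼ℚ (steps zs d) F ≡ 𝔼ℚ d (λ st → 𝔼ℚ (steps zs (return st)) F)
  𝔼ℚ-steps [] d F = 𝔼ℚ-cong d (λ st → sym (𝔼ℚ-return st F))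
  𝔼ℚ-steps (z ∷ zs) d F = begin
    𝔼ℚ (steps zs d >>= step-z) F
      ≡⟨ 𝔼ℚ-bind (steps zs d) step-z F ⟩
    𝔼ℚ (steps zs d) (λ st → 𝔼ℚ (step-z st) F)
      ≡⟨ 𝔼ℚ-steps zs d _ ⟩
    𝔼ℚ d (λ st → 𝔼ℚ (steps zs (return st)) (λ st′ → 𝔼ℚ (step-z st′) F))
      ≡⟨ 𝔼ℚ-cong d (λ st → sym (𝔼ℚ-bind (steps zs (return st)) step-z F)) ⟩
    𝔼ℚ d (λ st → 𝔼ℚ (steps zs (return st) >>= step-z) F) ∎
    where
    open ≡-Reasoning
    step-z = λ st → step P ρ ℓt st z

  Surely-steps : ∀ {Inv : State m k → Set} zs → All (λ z → ∀ st → Inv st → Surely Inv (step P ρ ℓt st z)) zs →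
                 ∀ {st} → Inv st → Surely Inv (steps zs (return st))
  Surely-steps [] [] inv = Surely-return inv
  Surely-steps (z ∷ zs) (pres ∷ press) inv = Surely-bind _ _ (Surely-steps zs press inv) pres

  Coupled-steps : ∀ {R : State m k → State m k → Set} zs →
                  All (λ z → ∀ {a b} → R a b → Coupled R (step P ρ ℓt a z) (step P ρ ℓt b z)) zs →
                  ∀ {a b} → R a b → Coupled R (steps zs (return a)) (steps zs (return b))
  Coupled-steps [] [] r = Coupled-return r
  Coupled-steps (z ∷ zs) (pres ∷ press) r = Coupled-bind _ _ (Coupled-steps zs press r) pres

  mass-step : ∀ st i → mass (step P ρ ℓt st i) ≡ 1ℚ
  mass-step (c , flag) i with flag ∨ (toℕ i <ᵇ toℕ ℓt) | does (InQ? P ρ i (lookup (pos c)) (lookup (pos c) i))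
  ... | true  | _     = mass-uniformOr-map (lookup (pos c) i) (Qlist P ρ i (lookup (pos c))) _
  ... | false | false = mass-uniformOr-map (lookup (pos c) i) (Qlist P ρ i (lookup (pos c))) _
  ... | false | true  = 𝔼ℚ-return (c , flag) _

  mass-steps : ∀ zs st → mass (steps zs (return st)) ≡ 1ℚ
  mass-steps [] st = 𝔼ℚ-return st _
  mass-steps (z ∷ zs) st = mass-bind (steps zs (return st)) _ (mass-steps zs st) (λ st′ → mass-step st′ z)

  𝔼ℚ-step-forced : ∀ {c flag i} F → (flag ∨ (toℕ i <ᵇ toℕ ℓt)) ≡ true →
    𝔼ℚ (step P ρ ℓt (c , flag) i) F ≡
    𝔼ℚ (uniformOr (lookup (pos c) i) (Qlist P ρ i (lookup (pos c)))) (λ q → F (config (pos c [ i ]≔ q) (incr (X c) i) (Y c) , flag))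
  𝔼ℚ-step-forced {c} {flag} {i} F isForced rewrite isForced =
    𝔼ℚ-uniformOr-map (lookup (pos c) i) (Qlist P ρ i (lookup (pos c))) (λ q → config (pos c [ i ]≔ q) (incr (X c) i) (Y c) , flag) F

  𝔼ℚ-step-unforced : ∀ {c flag i} F → (flag ∨ (toℕ i <ᵇ toℕ ℓt)) ≡ false →
    ¬ InQ P ρ i (lookup (pos c)) (lookup (pos c) i) →
    𝔼ℚ (step P ρ ℓt (c , flag) i) F ≡
    𝔼ℚ (uniformOr (lookup (pos c) i) (Qlist P ρ i (lookup (pos c)))) (λ q → F (config (pos c [ i ]≔ q) (X c) (incr (Y c) i) , true))
  𝔼ℚ-step-unforced {c} {flag} {i} F notForced leaves rewrite notForced with InQ? P ρ i (lookup (pos c)) (lookup (pos c) i)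
  ... | yes stays = ⊥-elim (leaves stays)
  ... | no  _     =
    𝔼ℚ-uniformOr-map (lookup (pos c) i) (Qlist P ρ i (lookup (pos c))) (λ q → config (pos c [ i ]≔ q) (X c) (incr (Y c) i) , true) F

  𝔼ℚ-step-stays : ∀ {c flag i} F → (flag ∨ (toℕ i <ᵇ toℕ ℓt)) ≡ false → InQ P ρ i (lookup (pos c)) (lookup (pos c) i) →
    𝔼ℚ (step P ρ ℓt (c , flag) i) F ≡ F (c , flag)
  𝔼ℚ-step-stays {c} {flag} {i} F notForced stays rewrite notForced with InQ? P ρ i (lookup (pos c)) (lookup (pos c) i)
  ... | yes _      = 𝔼ℚ-return (c , flag) F
  ... | no  leaves = ⊥-elim (leaves stays)

  -- On an empty candidate set uniformOr leaves the server where it is.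
  MovesTo : Fin k → Config m k → Fin m → Set
  MovesTo i c q = ∃ (InQ P ρ i (lookup (pos c))) → InQ P ρ i (lookup (pos c)) q

  data Outcome (i : Fin k) : State m k → State m k → Set where
    forced   : ∀ {c flag q} → (flag ∨ (toℕ i <ᵇ toℕ ℓt)) ≡ true → MovesTo i c q →
               Outcome i (c , flag) (config (pos c [ i ]≔ q) (incr (X c) i) (Y c) , flag)
    unforced : ∀ {c flag q} → MovesTo i c q →
               Outcome i (c , flag) (config (pos c [ i ]≔ q) (X c) (incr (Y c) i) , true)
    stays    : ∀ {c flag} → InQ P ρ i (lookup (pos c)) (lookup (pos c) i) → Outcome i (c , flag) (c , flag)

  Surely-MovesTo : ∀ i c → Surely (MovesTo i c) (uniformOr (lookup (pos c) i) (Qlist P ρ i (lookup (pos c))))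
  Surely-MovesTo i c = Surely-uniformOr _ _ Q≡[]⇒ (All.map (λ q∈Q _ → q∈Q) (All-InQ-Qlist P ρ i _))
    where
    Q≡[]⇒ : Qlist P ρ i (lookup (pos c)) ≡ [] → MovesTo i c (lookup (pos c) i)
    Q≡[]⇒ Q≡[] (_ , q∈Q) = ⊥-elim (ℕ.<-irrefl (sym (cong length Q≡[])) (0<length-Qlist P ρ q∈Q))

  Surely-Outcome : ∀ st i → Surely (Outcome i st) (step P ρ ℓt st i)
  Surely-Outcome (c , flag) i with flag ∨ (toℕ i <ᵇ toℕ ℓt) in isForced | InQ? P ρ i (lookup (pos c)) (lookup (pos c) i)
  ... | true  | _        = Surely-bind _ _ (Surely-MovesTo i c) (λ _ → Surely-return ∘ forced isForced)
  ... | false | no _     = Surely-bind _ _ (Surely-MovesTo i c) (λ _ → Surely-return ∘ unforced)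
  ... | false | yes stay = Surely-return (stays stay)

  step-coupled : ∀ {R : State m k → State m k → Set} i {c c′ flag} →
    (∀ j → toℕ i ℕ.≤ toℕ j → lookup (pos c) j ≡ lookup (pos c′) j) →
    (∀ q → R (config (pos c [ i ]≔ q) (incr (X c) i) (Y c) , flag) (config (pos c′ [ i ]≔ q) (incr (X c′) i) (Y c′) , flag)) →
    (∀ q → R (config (pos c [ i ]≔ q) (X c) (incr (Y c) i) , true) (config (pos c′ [ i ]≔ q) (X c′) (incr (Y c′) i) , true)) →
    R (c , flag) (c′ , flag) →
    Coupled R (step P ρ ℓt (c , flag) i) (step P ρ ℓt (c′ , flag) i)
  step-coupled i {c} {c′} {flag} agree Rforced Runforced Rstay
    with flag ∨ (toℕ i <ᵇ toℕ ℓt)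
       | InQ? P ρ i (lookup (pos c)) (lookup (pos c) i) | InQ? P ρ i (lookup (pos c′)) (lookup (pos c′) i)
  ... | true  | _        | _         = Coupled-uniformOr-map _ _ (agree i ℕ.≤-refl) sameQ Rforced
    where sameQ = Qlist-cong P ρ i (λ j i<j → agree j (ℕ.<⇒≤ i<j))
  ... | false | no _     | no _      = Coupled-uniformOr-map _ _ (agree i ℕ.≤-refl) sameQ Runforced
    where sameQ = Qlist-cong P ρ i (λ j i<j → agree j (ℕ.<⇒≤ i<j))
  ... | false | yes _    | yes _     = Coupled-return Rstay
  ... | false | yes stay | no ¬stay′ = ⊥-elim (¬stay′ (InQ-cong-self P ρ i agree stay))
  ... | false | no ¬stay | yes stay′ = ⊥-elim (¬stay (InQ-cong-self P ρ i (λ j i≤j → sym (agree j i≤j)) stay′))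

  step-lands-in-Q : ∀ i {c flag} → ∃ (InQ P ρ i (lookup (pos c))) →
                    Surely (λ st → InQ P ρ i (lookup (pos (proj₁ st))) (lookup (pos (proj₁ st)) i)) (step P ρ ℓt (c , flag) i)
  step-lands-in-Q i {c} {flag} nonempty = Surely-map lands (Surely-Outcome (c , flag) i)
    where
    moved : ∀ {q} → MovesTo i c q → InQ P ρ i (lookup (pos c [ i ]≔ q)) (lookup (pos c [ i ]≔ q) i)
    moved {q} q∈Q = subst (InQ P ρ i _) (sym (Vec.lookup∘update i (pos c) q))
      (InQ-cong P ρ i (λ j i<j → sym (Vec.lookup∘update′ (Fin.<⇒≢ i<j ∘ sym) (pos c) q)) (q∈Q nonempty))
    lands : ∀ {st} → Outcome i (c , flag) st → InQ P ρ i (lookup (pos (proj₁ st))) (lookup (pos (proj₁ st)) i)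
    lands (forced _ q∈Q) = moved q∈Q
    lands (unforced q∈Q) = moved q∈Q
    lands (stays p[i]∈Q) = p[i]∈Q

  NonEmptyAt : Fin k → State m k → Set
  NonEmptyAt i st = ∃ (InQ P ρ i (lookup (pos (proj₁ st))))

  Surely-NonEmptyAt : HasFeasibleLabeling P ρ → ∀ {x zs} → LevelsAbove x zs → ∀ st →
                      Surely (NonEmptyAt x) (steps zs (return st))
  Surely-NonEmptyAt feasible (top 1+x≡k) st = Surely-return (InQ-top P ρ _ 1+x≡k feasible)
  Surely-NonEmptyAt feasible {zs = y ∷ zs} (next y≡1+x above) st =
    Surely-bind (steps zs (return st)) _ (Surely-NonEmptyAt feasible above st)
      (λ { (c , flag) nonempty → Surely-map (InQ-lower P ρ _ y≡1+x) (step-lands-in-Q y {c} {flag} nonempty) })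

module Locality {m k : ℕ} (ℓ : Fin k) where

  -- Everything the future of server ℓ depends on.
  record _≈_ (c c′ : Config m k) : Set where
    constructor mk≈
    field
      pos≈ : ∀ j → toℕ ℓ ℕ.≤ toℕ j → lookup (pos c) j ≡ lookup (pos c′) j
      X≈   : lookup (X c) ℓ ≡ lookup (X c′) ℓ
      Y≈   : lookup (Y c) ℓ ≡ lookup (Y c′) ℓ

  record _≈ˢ_ (st st′ : State m k) : Set where
    constructor mk≈ˢ
    field
      config≈ : proj₁ st ≈ proj₁ st′
      flag≡   : proj₂ st ≡ proj₂ st′

  Respects≈ : (Config m k → ℚ) → Set
  Respects≈ G = ∀ {c c′} → c ≈ c′ → G c ≡ G c′

  ≈-refl : ∀ {c} → c ≈ c
  ≈-refl = mk≈ (λ _ _ → refl) refl refl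

  ≈-trans : ∀ {c c′ c″} → c ≈ c′ → c′ ≈ c″ → c ≈ c″
  ≈-trans (mk≈ pos≈ X≈ Y≈) (mk≈ pos≈′ X≈′ Y≈′) =
    mk≈ (λ j ℓ≤j → trans (pos≈ j ℓ≤j) (pos≈′ j ℓ≤j)) (trans X≈ X≈′) (trans Y≈ Y≈′)

  setℓ : Fin m → Config m k → Config m k
  setℓ s c = config (pos c [ ℓ ]≔ s) (X c) (Y c)

  setˢ : Fin m → State m k → State m k
  setˢ s (c , flag) = setℓ s c , flag

  setℓ-above : ∀ x c j → toℕ ℓ ℕ.< toℕ j → lookup (pos (setℓ x c)) j ≡ lookup (pos c) j
  setℓ-above x c j ℓ<j = Vec.lookup∘update′ (Fin.<⇒≢ ℓ<j ∘ sym) (pos c) x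

  module _ {n} (P : Pattern k (suc n)) (ρ : Fin (suc n) → Fin m) where

    Qlist-setℓ : ∀ x c → Qlist P ρ ℓ (lookup (pos (setℓ x c))) ≡ Qlist P ρ ℓ (lookup (pos c))
    Qlist-setℓ x c = Qlist-cong P ρ ℓ (setℓ-above x c)

    InQ-setℓ⁺ : ∀ {x c} → InQ P ρ ℓ (lookup (pos c)) x → InQ P ρ ℓ (lookup (pos (setℓ x c))) (lookup (pos (setℓ x c)) ℓ)
    InQ-setℓ⁺ {x} {c} =
      subst (InQ P ρ ℓ _) (sym (Vec.lookup∘update ℓ (pos c) x)) ∘ InQ-cong P ρ ℓ (λ j ℓ<j → sym (setℓ-above x c j ℓ<j))

    InQ-setℓ⁻ : ∀ {x c} → InQ P ρ ℓ (lookup (pos (setℓ x c))) (lookup (pos (setℓ x c)) ℓ) → InQ P ρ ℓ (lookup (pos c)) x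
    InQ-setℓ⁻ {x} {c} = InQ-cong P ρ ℓ (setℓ-above x c) ∘ subst (InQ P ρ ℓ _) (Vec.lookup∘update ℓ (pos c) x)

    nonempty-setℓ : ∀ {x c} → ∃ (InQ P ρ ℓ (lookup (pos c))) → ∃ (InQ P ρ ℓ (lookup (pos (setℓ x c))))
    nonempty-setℓ {x} {c} (q , q∈Q) = q , InQ-cong P ρ ℓ (λ j ℓ<j → sym (setℓ-above x c j ℓ<j)) q∈Q

  lookup-update-agree : ∀ {A : Set} {v v′ : Vec A k} i x j → lookup v j ≡ lookup v′ j →
                        lookup (v [ i ]≔ x) j ≡ lookup (v′ [ i ]≔ x) j
  lookup-update-agree {v = v} {v′} i x j vj≡v′j with i Fin.≟ j
  ... | yes refl = trans (Vec.lookup∘update i v x) (sym (Vec.lookup∘update i v′ x))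
  ... | no  i≢j  = trans (Vec.lookup∘update′ (i≢j ∘ sym) v x) (trans vj≡v′j (sym (Vec.lookup∘update′ (i≢j ∘ sym) v′ x)))

  lookup-incr-agree : ∀ {v v′ : Vec ℕ k} i j → lookup v j ≡ lookup v′ j → lookup (incr v i) j ≡ lookup (incr v′ i) j
  lookup-incr-agree {v} {v′} i j vj≡v′j with i Fin.≟ j
  ... | yes refl = trans (Vec.lookup∘update i v _) (trans (cong suc vj≡v′j) (sym (Vec.lookup∘update i v′ _)))
  ... | no  i≢j  = trans (Vec.lookup∘update′ (i≢j ∘ sym) v _) (trans vj≡v′j (sym (Vec.lookup∘update′ (i≢j ∘ sym) v′ _)))

  module _ {n} (P : Pattern k (suc n)) (ρ : Fin (suc n) → Fin m) (ℓt : Fin (suc k)) where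

    step-below : ∀ {i} → toℕ i ℕ.< toℕ ℓ → ∀ st → Surely (λ st′ → proj₁ st′ ≈ proj₁ st) (step P ρ ℓt st i)
    step-below {i} i<ℓ st = Surely-map unchanged (Surely-Outcome P ρ ℓt st i)
      where
      i≢ : ∀ {j} → toℕ ℓ ℕ.≤ toℕ j → j ≢ i
      i≢ ℓ≤j refl = ℕ.<⇒≱ i<ℓ ℓ≤j
      unchanged : ∀ {st′} → Outcome P ρ ℓt i st st′ → proj₁ st′ ≈ proj₁ st
      unchanged (forced {c} _ _) =
        mk≈ (λ j ℓ≤j → Vec.lookup∘update′ (i≢ ℓ≤j) (pos c) _) (Vec.lookup∘update′ (i≢ ℕ.≤-refl) (X c) _) refl
      unchanged (unforced {c} _) =
        mk≈ (λ j ℓ≤j → Vec.lookup∘update′ (i≢ ℓ≤j) (pos c) _) refl (Vec.lookup∘update′ (i≢ ℕ.≤-refl) (Y c) _)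
      unchanged (stays _)        = ≈-refl

    step-above-≈ : ∀ {i} → toℕ ℓ ℕ.≤ toℕ i → ∀ {st st′} → st ≈ˢ st′ →
                   Coupled _≈ˢ_ (step P ρ ℓt st i) (step P ρ ℓt st′ i)
    step-above-≈ {i} ℓ≤i {c , flag} {c′ , _} (mk≈ˢ c≈c′@(mk≈ pos≈ X≈ Y≈) refl) =
      step-coupled P ρ ℓt i {c} {c′} {flag} (λ j i≤j → pos≈ j (ℕ.≤-trans ℓ≤i i≤j))
        (λ q → mk≈ˢ (mk≈ (pos≈′ q) (lookup-incr-agree {X c} {X c′} i ℓ X≈) Y≈) refl)
        (λ q → mk≈ˢ (mk≈ (pos≈′ q) X≈ (lookup-incr-agree {Y c} {Y c′} i ℓ Y≈)) refl)
        (mk≈ˢ c≈c′ refl)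
      where
      pos≈′ : ∀ q j → toℕ ℓ ℕ.≤ toℕ j → lookup (pos c [ i ]≔ q) j ≡ lookup (pos c′ [ i ]≔ q) j
      pos≈′ q j ℓ≤j = lookup-update-agree {v = pos c} {pos c′} i q j (pos≈ j ℓ≤j)

    step-above-setℓ : ∀ {i} → toℕ ℓ ℕ.< toℕ i → ∀ s st →
                      Coupled (λ a b → a ≡ setˢ s b) (step P ρ ℓt (setˢ s st) i) (step P ρ ℓt st i)
    step-above-setℓ {i} ℓ<i s (c , flag) =
      step-coupled P ρ ℓt i {setℓ s c} {c} {flag} (λ j i≤j → setℓ-above s c j (ℕ.<-≤-trans ℓ<i i≤j))
        (λ q → cong (λ v → config v (incr (X c) i) (Y c) , flag) (commutes q))
        (λ q → cong (λ v → config v (X c) (incr (Y c) i) , true) (commutes q))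
        refl
      where
      commutes : ∀ q → (pos c [ ℓ ]≔ s) [ i ]≔ q ≡ (pos c [ i ]≔ q) [ ℓ ]≔ s
      commutes q = Vec.[]≔-commutes (pos c) ℓ i (Fin.<⇒≢ ℓ<i)

    steps-below : ∀ {zs} → All (λ z → toℕ z ℕ.< toℕ ℓ) zs → ∀ {G} → Respects≈ G → ∀ st →
                  𝔼ℚ (steps P ρ ℓt zs (return st)) (G ∘ proj₁) ≡ G (proj₁ st)
    steps-below {zs} below G≈ st = 𝔼ℚ-constˢ _ (mass-steps P ρ ℓt zs st) (Surely-map G≈ (Surely-steps P ρ ℓt zs pres ≈-refl))
      where
      pres : All (λ z → ∀ st′ → proj₁ st′ ≈ proj₁ st →
                        Surely (λ st″ → proj₁ st″ ≈ proj₁ st) (step P ρ ℓt st′ z)) zs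
      pres = All.map (λ z<ℓ st′ st′≈st → Surely-map (λ st″≈st′ → ≈-trans st″≈st′ st′≈st) (step-below z<ℓ st′)) below

    steps-above-≈ : ∀ {zs} → All (λ z → toℕ ℓ ℕ.≤ toℕ z) zs → ∀ {st st′} → st ≈ˢ st′ →
                    Coupled _≈ˢ_ (steps P ρ ℓt zs (return st)) (steps P ρ ℓt zs (return st′))
    steps-above-≈ {zs} above = Coupled-steps P ρ ℓt zs (All.map step-above-≈ above)

    steps-above-setℓ : ∀ {zs} → All (λ z → toℕ ℓ ℕ.< toℕ z) zs → ∀ s st →
                       Coupled (λ a b → a ≡ setˢ s b) (steps P ρ ℓt zs (return (setˢ s st))) (steps P ρ ℓt zs (return st))
    steps-above-setℓ {zs} above s st =
      Coupled-steps P ρ ℓt zs (All.map (λ ℓ<z → λ { {b = b} refl → step-above-setℓ ℓ<z s b }) above) refl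

  private
    split : ∃₂ λ xs ys → allFin k ≡ xs ++ ℓ ∷ ys × All (λ j → toℕ j ℕ.< toℕ ℓ) xs × LevelsAbove ℓ ys
    split = allFin-split k ℓ

  lower upper : List (Fin k)
  lower = proj₁ split
  upper = proj₁ (proj₂ split)

  allFin≡lower++ℓ∷upper : allFin k ≡ lower ++ ℓ ∷ upper
  allFin≡lower++ℓ∷upper = proj₁ (proj₂ (proj₂ split))

  lower<ℓ : All (λ j → toℕ j ℕ.< toℕ ℓ) lower
  lower<ℓ = proj₁ (proj₂ (proj₂ (proj₂ split)))

  LevelsAbove-upper : LevelsAbove ℓ upper
  LevelsAbove-upper = proj₂ (proj₂ (proj₂ (proj₂ split)))

  ℓ<upper : All (λ j → toℕ ℓ ℕ.< toℕ j) upper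
  ℓ<upper = LevelsAbove⇒All> LevelsAbove-upper

  value : ∀ {s} → Pattern k s → (Fin s → Fin m) → Input m k → (Config m k → ℚ) → Config m k → ℚ
  value P ρ rest G c = 𝔼ℚ (runFrom P ρ c rest) G

  valueBeforeℓ : ∀ {n} → Pattern k (suc n) → (Fin (suc n) → Fin m) → Fin (suc k) → Input m k →
                 (Config m k → ℚ) → State m k → ℚ
  valueBeforeℓ P ρ ℓt rest G st = 𝔼ℚ (step P ρ ℓt st ℓ) (value P ρ rest G ∘ proj₁)

  module _ {s} (P : Pattern k s) (ρ : Fin s → Fin m) (σ : Fin m) (ℓt : Fin (suc k)) (rest : Input m k) (G : Config m k → ℚ) where

    private
      P′ : Pattern k (suc s)
      P′ = extend P ℓt
      ρ′ : Fin (suc s) → Fin m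
      ρ′ = snoc ρ σ

    value-round : Respects≈ (value P′ ρ′ rest G) → ∀ c →
                  value P ρ ((σ , ℓt) ∷ rest) G c ≡
                  𝔼ℚ (steps P′ ρ′ ℓt upper (return (c , false))) (valueBeforeℓ P′ ρ′ ℓt rest G)
    value-round V≈ c = begin
      𝔼ℚ (round P′ ρ′ ℓt c >>= λ c′ → runFrom P′ ρ′ c′ rest) G
        ≡⟨ 𝔼ℚ-bind (round P′ ρ′ ℓt c) _ G ⟩
      𝔼ℚ (round P′ ρ′ ℓt c) V
        ≡⟨ 𝔼ℚ-round P′ ρ′ ℓt c V ⟩
      𝔼ℚ (steps P′ ρ′ ℓt (allFin k) start) (V ∘ proj₁)
        ≡⟨ cong (λ zs → 𝔼ℚ (steps P′ ρ′ ℓt zs start) (V ∘ proj₁)) allFin≡lower++ℓ∷upper ⟩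
      𝔼ℚ (steps P′ ρ′ ℓt (lower ++ ℓ ∷ upper) start) (V ∘ proj₁)
        ≡⟨ cong (λ d → 𝔼ℚ d (V ∘ proj₁)) (steps-++ P′ ρ′ ℓt lower (ℓ ∷ upper) start) ⟩
      𝔼ℚ (steps P′ ρ′ ℓt lower (steps P′ ρ′ ℓt (ℓ ∷ upper) start)) (V ∘ proj₁)
        ≡⟨ 𝔼ℚ-steps P′ ρ′ ℓt lower _ (V ∘ proj₁) ⟩
      𝔼ℚ (steps P′ ρ′ ℓt (ℓ ∷ upper) start) (λ st → 𝔼ℚ (steps P′ ρ′ ℓt lower (return st)) (V ∘ proj₁))
        ≡⟨ 𝔼ℚ-cong (steps P′ ρ′ ℓt (ℓ ∷ upper) start) (steps-below P′ ρ′ ℓt lower<ℓ V≈) ⟩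
      𝔼ℚ (steps P′ ρ′ ℓt (ℓ ∷ upper) start) (V ∘ proj₁)
        ≡⟨ 𝔼ℚ-bind (steps P′ ρ′ ℓt upper start) (λ st → step P′ ρ′ ℓt st ℓ) (V ∘ proj₁) ⟩
      𝔼ℚ (steps P′ ρ′ ℓt upper start) (valueBeforeℓ P′ ρ′ ℓt rest G) ∎
      where
      open ≡-Reasoning
      V = value P′ ρ′ rest G
      start = return (c , false)

  valueBeforeℓ-respects≈ : ∀ {n} (P : Pattern k (suc n)) ρ ℓt rest {G} → Respects≈ (value P ρ rest G) →
                           ∀ {st st′} → st ≈ˢ st′ → valueBeforeℓ P ρ ℓt rest G st ≡ valueBeforeℓ P ρ ℓt rest G st′
  valueBeforeℓ-respects≈ P ρ ℓt rest V≈ st≈st′ =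
    Coupled-𝔼ℚ (λ a≈b → V≈ (_≈ˢ_.config≈ a≈b)) (step-above-≈ P ρ ℓt ℕ.≤-refl st≈st′)

  value-respects≈ : ∀ rest {s} (P : Pattern k s) ρ {G} → Respects≈ G → Respects≈ (value P ρ rest G)
  value-respects≈ [] P ρ {G} G≈ {c} {c′} c≈c′ = begin
    𝔼ℚ (return c) G   ≡⟨ 𝔼ℚ-return c G ⟩
    G c               ≡⟨ G≈ c≈c′ ⟩
    G c′              ≡⟨ 𝔼ℚ-return c′ G ⟨
    𝔼ℚ (return c′) G  ∎
    where open ≡-Reasoning
  value-respects≈ ((σ , ℓt) ∷ rest) P ρ {G} G≈ {c} {c′} c≈c′ = begin
    value P ρ ((σ , ℓt) ∷ rest) G c
      ≡⟨ value-round P ρ σ ℓt rest G V≈ c ⟩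
    𝔼ℚ (steps P′ ρ′ ℓt upper (return (c , false))) (valueBeforeℓ P′ ρ′ ℓt rest G)
      ≡⟨ Coupled-𝔼ℚ (valueBeforeℓ-respects≈ P′ ρ′ ℓt rest V≈)
                    (steps-above-≈ P′ ρ′ ℓt (All.map ℕ.<⇒≤ ℓ<upper) (mk≈ˢ c≈c′ refl)) ⟩
    𝔼ℚ (steps P′ ρ′ ℓt upper (return (c′ , false))) (valueBeforeℓ P′ ρ′ ℓt rest G)
      ≡⟨ value-round P ρ σ ℓt rest G V≈ c′ ⟨
    value P ρ ((σ , ℓt) ∷ rest) G c′ ∎
    where
    open ≡-Reasoning
    P′ = extend P ℓt
    ρ′ = snoc ρ σ
    V≈ = value-respects≈ rest P′ ρ′ G≈

  value-setℓ : ∀ {s} (P : Pattern k s) ρ σ ℓt rest {G} → Respects≈ G → ∀ c x →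
               value P ρ ((σ , ℓt) ∷ rest) G (setℓ x c) ≡
               𝔼ℚ (steps (extend P ℓt) (snoc ρ σ) ℓt upper (return (c , false)))
                  (λ st → valueBeforeℓ (extend P ℓt) (snoc ρ σ) ℓt rest G (setˢ x st))
  value-setℓ P ρ σ ℓt rest {G} G≈ c x =
    trans (value-round P ρ σ ℓt rest G (value-respects≈ rest (extend P ℓt) (snoc ρ σ) G≈) (setℓ x c))
          (Coupled-𝔼ℚ (λ { refl → refl }) (steps-above-setℓ (extend P ℓt) (snoc ρ σ) ℓt ℓ<upper x (c , false)))

  record AfterUpper (c : Config m k) (ℓt : Fin (suc k)) (st : State m k) : Set where
    constructor mkAfterUpper
    field
      X≡      : lookup (X (proj₁ st)) ℓ ≡ lookup (X c) ℓ
      Y≡      : lookup (Y (proj₁ st)) ℓ ≡ lookup (Y c) ℓ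
      unmoved : proj₂ st ≡ false → toℕ ℓt ℕ.≤ toℕ ℓ →
                ∀ j → toℕ ℓ ℕ.< toℕ j → lookup (pos (proj₁ st)) j ≡ lookup (pos c) j

  module _ {n} (P : Pattern k (suc n)) (ρ : Fin (suc n) → Fin m) (ℓt : Fin (suc k)) (c : Config m k) where

    step-above-AfterUpper : ∀ {i} → toℕ ℓ ℕ.< toℕ i → ∀ st → AfterUpper c ℓt st →
                            Surely (AfterUpper c ℓt) (step P ρ ℓt st i)
    step-above-AfterUpper {i} ℓ<i st (mkAfterUpper X≡ Y≡ unmoved) = Surely-map preserved (Surely-Outcome P ρ ℓt st i)
      where
      ℓ≢i : ℓ ≢ i
      ℓ≢i = Fin.<⇒≢ ℓ<i
      preserved : ∀ {st′} → Outcome P ρ ℓt i st st′ → AfterUpper c ℓt st′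
      preserved (forced {c′} {false} i<ℓt _) =
        mkAfterUpper (trans (Vec.lookup∘update′ ℓ≢i (X c′) _) X≡) Y≡
          (λ _ ℓt≤ℓ → ⊥-elim (ℕ.<-asym ℓ<i (ℕ.<-≤-trans (<ᵇ≡true⇒< i<ℓt) ℓt≤ℓ)))
      preserved (forced {c′} {true} _ _) = mkAfterUpper (trans (Vec.lookup∘update′ ℓ≢i (X c′) _) X≡) Y≡ (λ ())
      preserved (unforced {c′} _) = mkAfterUpper X≡ (trans (Vec.lookup∘update′ ℓ≢i (Y c′) _) Y≡) (λ ())
      preserved (stays _) = mkAfterUpper X≡ Y≡ unmoved

    Surely-AfterUpper : Surely (AfterUpper c ℓt) (steps P ρ ℓt upper (return (c , false)))
    Surely-AfterUpper = Surely-steps P ρ ℓt upper (All.map step-above-AfterUpper ℓ<upper) (mkAfterUpper refl refl (λ _ _ _ _ → refl))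

DichotomyAt : (m k : ℕ) → Fin k → ℕ → Set
DichotomyAt m k ℓ N =
  ∀ t (ρ : Fin (suc t) → Fin m) (P : Pattern k (suc t)) → HSP P →
  ∀ p → (∀ q → InQ P ρ ℓ p q) ⊎ length (Qlist P ρ ℓ p) ℕ.≤ N

module _ {m k : ℕ} (ℓ : Fin k) (N : ℕ) where

  open Locality {m} ℓ

  excess : Config m k → ℚ
  excess c = ι (lookup (Y c) ℓ) - H N * ι (lookup (X c) ℓ)

  excess-cong : ∀ {c c′} → lookup (X c) ℓ ≡ lookup (X c′) ℓ → lookup (Y c) ℓ ≡ lookup (Y c′) ℓ →
                excess c ≡ excess c′
  excess-cong X≡ Y≡ = cong₂ (λ y x → ι y - H N * ι x) Y≡ X≡

  excess-respects≈ : Respects≈ excess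
  excess-respects≈ {c} {c′} (mk≈ _ X≈ Y≈) = excess-cong {c} {c′} X≈ Y≈

  excess-incrX : ∀ c → excess (config (pos c) (incr (X c) ℓ) (Y c)) ≡ excess c - H N
  excess-incrX c = begin
    ι y - H N * ι (lookup (incr (X c) ℓ) ℓ)  ≡⟨ cong (λ n → ι y - H N * ι n) (Vec.lookup∘update ℓ (X c) _) ⟩
    ι y - H N * ι (suc x)                     ≡⟨ cong (λ z → ι y - H N * z) (ι-suc x) ⟩
    ι y - H N * (1ℚ + ι x)                    ≡⟨ solve 3 (λ y h x → y :- h :* (con 1ℚ :+ x) := y :- h :* x :- h) refl (ι y) (H N) (ι x) ⟩
    ι y - H N * ι x - H N                     ∎
    where
    open ≡-Reasoning
    x = lookup (X c) ℓ
    y = lookup (Y c) ℓ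

  excess-incrY : ∀ c → excess (config (pos c) (X c) (incr (Y c) ℓ)) ≡ excess c + 1ℚ
  excess-incrY c = begin
    ι (lookup (incr (Y c) ℓ) ℓ) - H N * ι x  ≡⟨ cong (λ n → ι n - H N * ι x) (Vec.lookup∘update ℓ (Y c) _) ⟩
    ι (suc y) - H N * ι x                     ≡⟨ cong (λ z → z - H N * ι x) (ι-suc y) ⟩
    1ℚ + ι y - H N * ι x                      ≡⟨ solve 3 (λ y h x → con 1ℚ :+ y :- h :* x := y :- h :* x :+ con 1ℚ) refl (ι y) (H N) (ι x) ⟩
    ι y - H N * ι x + 1ℚ                      ∎
    where
    open ≡-Reasoning
    x = lookup (X c) ℓ
    y = lookup (Y c) ℓ

  excess-initial : ∀ init → excess (config init (replicate k 0) (replicate k 0)) ≡ 0ℚ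
  excess-initial init = begin
    ι (lookup (replicate k 0) ℓ) - H N * ι (lookup (replicate k 0) ℓ)  ≡⟨ cong (λ n → ι n - H N * ι n) (Vec.lookup-replicate ℓ 0) ⟩
    0ℚ - H N * 0ℚ                                                      ≡⟨ solve 1 (λ h → con 0ℚ :- h :* con 0ℚ := con 0ℚ) refl (H N) ⟩
    0ℚ                                                                 ∎
    where open ≡-Reasoning

  Qℓ : ∀ {n} → Pattern k (suc n) → (Fin (suc n) → Fin m) → Config m k → List (Fin m)
  Qℓ P ρ c = Qlist P ρ ℓ (lookup (pos c))

  -- The sum over s ∈ Qℓ is |Qℓ| times the expectation when server ℓ is placed uniformly on Qℓ.
  PotentialBound : Input m k → Set
  PotentialBound rest =
    ∀ {n} (P : Pattern k (suc n)) ρ c → HSP P → ValidFrom P ρ rest → ∃ (InQ P ρ ℓ (lookup (pos c))) →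
    ∑ (Qℓ P ρ c) (λ s → value P ρ rest excess (setℓ s c))
      ≤ ι (length (Qℓ P ρ c)) * (excess c + potential N (length (Qℓ P ρ c)))

  PotentialBound-[] : PotentialBound []
  PotentialBound-[] P ρ c _ _ nonempty = begin
    ∑ Q (λ x → 𝔼ℚ (return (setℓ x c)) excess)  ≡⟨ ∑-cong Q (λ x → 𝔼ℚ-return (setℓ x c) excess) ⟩
    ∑ Q (λ _ → excess c)                       ≡⟨ ∑-const Q (excess c) ⟩
    ι (length Q) * excess c                    ≤⟨ ι*x≤ι*[x+potential] N (0<length-Qlist P ρ (proj₂ nonempty)) ⟩
    ι (length Q) * (excess c + potential N (length Q)) ∎
    where
    open ℚ.≤-Reasoning
    Q = Qℓ P ρ c

  module _ (dichotomy : DichotomyAt m k ℓ N) where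

    module Round {rest} (ih : PotentialBound rest) {s} (P : Pattern k s) (ρ : Fin s → Fin m) (σ : Fin m) (ℓt : Fin (suc k))
                 (hsp : HSP (extend P ℓt)) (valid : ValidFrom (extend P ℓt) (snoc ρ σ) rest) where

      P′ : Pattern k (suc s)
      P′ = extend P ℓt

      ρ′ : Fin (suc s) → Fin m
      ρ′ = snoc ρ σ

      V : Config m k → ℚ
      V = value P′ ρ′ rest excess

      W : State m k → ℚ
      W = valueBeforeℓ P′ ρ′ ℓt rest excess

      W-forced : ∀ {c flag} → (flag ∨ (toℕ ℓ <ᵇ toℕ ℓt)) ≡ true → ∃ (InQ P′ ρ′ ℓ (lookup (pos c))) →
                 W (c , flag) ≤ excess c
      W-forced {c} {flag} isForced nonempty = ι*-cancelˡ-≤ 0<a (begin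
        ι a * W (c , flag)                        ≡⟨ cong (ι a *_) (𝔼ℚ-step-forced P′ ρ′ ℓt (V ∘ proj₁) isForced) ⟩
        ι a * 𝔼ℚ (uniformOr _ Q) (λ q → V (setℓ q c⁺)) ≡⟨ ι*𝔼ℚ-uniformOr _ Q _ 0<a ⟩
        ∑ Q (λ q → V (setℓ q c⁺))                    ≤⟨ ih P′ ρ′ c⁺ hsp valid nonempty ⟩
        ι a * (excess c⁺ + potential N a)         ≤⟨ *-monoˡ-≤-0≤ (0≤ι a) excess⁺ ⟩
        ι a * excess c                            ∎)
        where
        open ℚ.≤-Reasoning
        c⁺ = config (pos c) (incr (X c) ℓ) (Y c)
        Q = Qℓ P′ ρ′ c
        a = length Q
        0<a = 0<length-Qlist P′ ρ′ (proj₂ nonempty)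
        excess⁺ : excess c⁺ + potential N a ≤ excess c
        excess⁺ = subst (λ e → e + potential N a ≤ excess c) (sym (excess-incrX c)) (x-y+z≤x (excess c) (potential≤H N a))

      W-stays : ∀ {c x} → (toℕ ℓ <ᵇ toℕ ℓt) ≡ false → InQ P′ ρ′ ℓ (lookup (pos c)) x →
                W (setℓ x c , false) ≡ V (setℓ x c)
      W-stays {c} notForced x∈Q′ = 𝔼ℚ-step-stays P′ ρ′ ℓt (V ∘ proj₁) notForced (InQ-setℓ⁺ P′ ρ′ {c = c} x∈Q′)

      W-leaves : ∀ {c x} → (toℕ ℓ <ᵇ toℕ ℓt) ≡ false → ∃ (InQ P′ ρ′ ℓ (lookup (pos c))) →
                 ¬ InQ P′ ρ′ ℓ (lookup (pos c)) x →
                 W (setℓ x c , false) ≤ excess c + 1ℚ + potential N (length (Qℓ P′ ρ′ c))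
      W-leaves {c} {x} notForced nonempty x∉Q′ = ι*-cancelˡ-≤ 0<b (begin
        ι b * W (setℓ x c , false)
          ≡⟨ cong (ι b *_) (𝔼ℚ-step-unforced P′ ρ′ ℓt (V ∘ proj₁) notForced (x∉Q′ ∘ InQ-setℓ⁻ P′ ρ′ {c = c})) ⟩
        ι b * 𝔼ℚ (uniformOr x′ (Qℓ P′ ρ′ (setℓ x c))) G
          ≡⟨ cong (λ L → ι b * 𝔼ℚ (uniformOr x′ L) G) (Qlist-setℓ P′ ρ′ x c) ⟩
        ι b * 𝔼ℚ (uniformOr x′ Q′) G
          ≡⟨ ι*𝔼ℚ-uniformOr x′ Q′ G 0<b ⟩
        ∑ Q′ G
          ≡⟨ ∑-cong Q′ (λ q → cong (λ v → V (config v (X c) (incr (Y c) ℓ))) (Vec.[]≔-idempotent (pos c) ℓ)) ⟩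
        ∑ Q′ (λ q → V (setℓ q c⁺))
          ≤⟨ ih P′ ρ′ c⁺ hsp valid nonempty ⟩
        ι b * (excess c⁺ + potential N b)
          ≡⟨ cong (λ e → ι b * (e + potential N b)) (excess-incrY c) ⟩
        ι b * (excess c + 1ℚ + potential N b) ∎)
        where
        open ℚ.≤-Reasoning
        c⁺ = config (pos c) (X c) (incr (Y c) ℓ)
        Q′ = Qℓ P′ ρ′ c
        b = length Q′
        0<b = 0<length-Qlist P′ ρ′ (proj₂ nonempty)
        x′ = lookup (pos (setℓ x c)) ℓ
        G = λ q → V (config ((pos c [ ℓ ]≔ x) [ ℓ ]≔ q) (X c) (incr (Y c) ℓ))

      ∑W-forced : ∀ {c flag} → (flag ∨ (toℕ ℓ <ᵇ toℕ ℓt)) ≡ true → ∃ (InQ P′ ρ′ ℓ (lookup (pos c))) →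
                  ∀ Q → 0 ℕ.< length Q → ∑ Q (λ x → W (setℓ x c , flag)) ≤ ι (length Q) * (excess c + potential N (length Q))
      ∑W-forced {c} {flag} isForced nonempty Q 0<a = begin
        ∑ Q (λ x → W (setℓ x c , flag))
          ≤⟨ ∑-monoᴬ (All.universal (λ _ → W-forced isForced (nonempty-setℓ P′ ρ′ {c = c} nonempty)) Q) ⟩
        ∑ Q (λ _ → excess c)
          ≡⟨ ∑-const Q (excess c) ⟩
        ι (length Q) * excess c
          ≤⟨ ι*x≤ι*[x+potential] N 0<a ⟩
        ι (length Q) * (excess c + potential N (length Q)) ∎
        where open ℚ.≤-Reasoning

      -- Q′ is the part of Q where server ℓ stays; from the other positions it moves, at cost 1.
      ∑W-unforced : ∀ {c} → (toℕ ℓ <ᵇ toℕ ℓt) ≡ false → ∃ (InQ P′ ρ′ ℓ (lookup (pos c))) →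
                    ∀ Q → filter (InQ? P′ ρ′ ℓ (lookup (pos c))) Q ≡ Qℓ P′ ρ′ c →
                    ∑ Q (λ x → W (setℓ x c , false)) ≤ ι (length Q) * (excess c + potential N (length Q))
      ∑W-unforced {c} notForced nonempty Q filter≡Q′ =
        subst (λ a → ∑ Q f ≤ ι a * (e + potential N a)) (sym a≡b+r) (begin
          ∑ Q f                                               ≡⟨ ∑-partition stays? Q f ⟩
          ∑ (filter stays? Q) f + ∑ (filter (∁? stays?) Q) f  ≤⟨ potential-merge N b r e 0<b dichotomy-case S₁≤ S₂≤ ⟩
          ι (b ℕ.+ r) * (e + potential N (b ℕ.+ r))           ∎)
        where
        open ℚ.≤-Reasoning
        stays? = InQ? P′ ρ′ ℓ (lookup (pos c))
        Q′ = Qℓ P′ ρ′ c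
        b = length Q′
        r = length (filter (∁? stays?) Q)
        e = excess c
        f = λ x → W (setℓ x c , false)
        0<b = 0<length-Qlist P′ ρ′ (proj₂ nonempty)
        a≡b+r : length Q ≡ b ℕ.+ r
        a≡b+r = trans (length-partition stays? Q) (cong (λ L → length L ℕ.+ r) filter≡Q′)
        S₁≤ : ∑ (filter stays? Q) f ≤ ι b * (e + potential N b)
        S₁≤ = begin
          ∑ (filter stays? Q) f              ≡⟨ ∑-congᴬ (All.map (W-stays notForced) (all-filter stays? Q)) ⟩
          ∑ (filter stays? Q) (λ x → V (setℓ x c)) ≡⟨ cong (λ L → ∑ L (λ x → V (setℓ x c))) filter≡Q′ ⟩
          ∑ Q′ (λ x → V (setℓ x c))             ≤⟨ ih P′ ρ′ c hsp valid nonempty ⟩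
          ι b * (e + potential N b)          ∎
        S₂≤ : ∑ (filter (∁? stays?) Q) f ≤ ι r * (e + 1ℚ + potential N b)
        S₂≤ = begin
          ∑ (filter (∁? stays?) Q) f
            ≤⟨ ∑-monoᴬ (All.map (W-leaves notForced nonempty) (all-filter (∁? stays?) Q)) ⟩
          ∑ (filter (∁? stays?) Q) (λ _ → e + 1ℚ + potential N b)
            ≡⟨ ∑-const (filter (∁? stays?) Q) _ ⟩
          ι r * (e + 1ℚ + potential N b) ∎
        dichotomy-case : b ℕ.≤ N ⊎ r ≡ 0
        dichotomy-case with dichotomy _ ρ′ P′ hsp (lookup (pos c))
        ... | inj₁ Q′-full = inj₂ (cong length (filter-none (∁? stays?) (All.universal (λ x x∉Q′ → x∉Q′ (Q′-full x)) Q)))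
        ... | inj₂ b≤N     = inj₁ b≤N

    PotentialBound-∷ : ∀ {σ ℓt rest} → PotentialBound rest → PotentialBound ((σ , ℓt) ∷ rest)
    PotentialBound-∷ {σ} {ℓt} {rest} ih P ρ c hsp (feasible , valid) nonempty = begin
      ∑ Q (λ x → value P ρ ((σ , ℓt) ∷ rest) excess (setℓ x c))
        ≡⟨ ∑-cong Q (value-setℓ P ρ σ ℓt rest excess-respects≈ c) ⟩
      ∑ Q (λ x → 𝔼ℚ D (W ∘ setˢ x))
        ≡⟨ ∑-𝔼ℚ Q D (λ x → W ∘ setˢ x) ⟩
      𝔼ℚ D (λ st → ∑ Q (λ x → W (setˢ x st)))
        ≤⟨ 𝔼ℚ-mono D {G = λ _ → K} (Surely-map after-upper (Surely-zip (Surely-AfterUpper P′ ρ′ ℓt c) nonempty′)) ⟩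
      𝔼ℚ D (λ _ → K)
        ≡⟨ 𝔼ℚ-const₁ D (mass-steps P′ ρ′ ℓt upper (c , false)) ⟩
      K ∎
      where
      open ℚ.≤-Reasoning
      open Round ih P ρ σ ℓt (HSP-extend ℓt hsp) valid
      Q = Qℓ P ρ c
      a = length Q
      K = ι a * (excess c + potential N a)
      D = steps P′ ρ′ ℓt upper (return (c , false))
      nonempty′ : Surely (NonEmptyAt P′ ρ′ ℓt ℓ) D
      nonempty′ = Surely-NonEmptyAt P′ ρ′ ℓt feasible LevelsAbove-upper (c , false)
      0<a = 0<length-Qlist P ρ (proj₂ nonempty)

      shrinks : ∀ {c₁} → toℕ ℓt ℕ.≤ toℕ ℓ → (∀ j → toℕ ℓ ℕ.< toℕ j → lookup (pos c₁) j ≡ lookup (pos c) j) →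
                filter (InQ? P′ ρ′ ℓ (lookup (pos c₁))) Q ≡ Qℓ P′ ρ′ c₁
      shrinks ℓt≤ℓ unmoved = filter-⊆ (InQ? P′ ρ′ ℓ _) (InQ? P ρ ℓ _)
        (InQ-cong P ρ ℓ unmoved ∘ InQ-restrict P ρ σ ℓt ℓ ℓt≤ℓ) (allFin m)

      sum-bound : ∀ {c₁} flag → ∃ (InQ P′ ρ′ ℓ (lookup (pos c₁))) →
                  (flag ≡ false → toℕ ℓt ℕ.≤ toℕ ℓ → ∀ j → toℕ ℓ ℕ.< toℕ j → lookup (pos c₁) j ≡ lookup (pos c) j) →
                  ∑ Q (λ x → W (setℓ x c₁ , flag)) ≤ ι a * (excess c₁ + potential N a)
      sum-bound {c₁} true  nonempty₁ _ = ∑W-forced {c₁} {true} refl nonempty₁ Q 0<a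
      sum-bound {c₁} false nonempty₁ unmoved = by-ℓt (toℕ ℓ <ᵇ toℕ ℓt) refl
        where
        by-ℓt : ∀ b → (toℕ ℓ <ᵇ toℕ ℓt) ≡ b →
                ∑ Q (λ x → W (setℓ x c₁ , false)) ≤ ι a * (excess c₁ + potential N a)
        by-ℓt true  forcedByℓt = ∑W-forced {c₁} {false} forcedByℓt nonempty₁ Q 0<a
        by-ℓt false notForced  = ∑W-unforced {c₁} notForced nonempty₁ Q (shrinks {c₁} ℓt≤ℓ (unmoved refl ℓt≤ℓ))
          where ℓt≤ℓ = <ᵇ≡false⇒≤ notForced

      after-upper : ∀ {st} → AfterUpper c ℓt st × NonEmptyAt P′ ρ′ ℓt ℓ st → ∑ Q (λ x → W (setˢ x st)) ≤ K
      after-upper {c₁ , flag} (mkAfterUpper X≡ Y≡ unmoved , nonempty₁) =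
        subst (λ e → ∑ Q (λ x → W (setℓ x c₁ , flag)) ≤ ι a * (e + potential N a))
              (excess-cong {c₁} {c} X≡ Y≡) (sum-bound flag nonempty₁ unmoved)

    potentialBound : ∀ rest → PotentialBound rest
    potentialBound []                 = PotentialBound-[]
    potentialBound ((σ , ℓt) ∷ rest) = PotentialBound-∷ {σ} {ℓt} {rest} (potentialBound rest)

    -- Every server is forced in the first round.
    𝔼ℚ-excess-run≤0 : ∀ init σ₁ rest → Valid ((σ₁ , fromℕ k) ∷ rest) →
                      𝔼ℚ (run init ((σ₁ , fromℕ k) ∷ rest)) excess ≤ 0ℚ
    𝔼ℚ-excess-run≤0 init σ₁ rest (feasible , valid) = begin
      value P₀ ρ₀ ((σ₁ , fromℕ k) ∷ rest) excess c₀
        ≡⟨ value-round P₀ ρ₀ σ₁ (fromℕ k) rest excess (value-respects≈ rest P′ ρ′ excess-respects≈) c₀ ⟩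
      𝔼ℚ D W
        ≤⟨ 𝔼ℚ-mono D {G = λ _ → 0ℚ} (Surely-map first-round (Surely-zip (Surely-AfterUpper P′ ρ′ (fromℕ k) c₀) nonempty)) ⟩
      𝔼ℚ D (λ _ → 0ℚ)
        ≡⟨ 𝔼ℚ-0 D ⟩
      0ℚ ∎
      where
      open ℚ.≤-Reasoning
      P₀ = emptyPattern k
      ρ₀ = emptyReq {m}
      c₀ = config init (replicate k 0) (replicate k 0)
      open Round (potentialBound rest) P₀ ρ₀ σ₁ (fromℕ k) HSP-first valid
      D = steps P′ ρ′ (fromℕ k) upper (return (c₀ , false))
      nonempty : Surely (NonEmptyAt P′ ρ′ (fromℕ k) ℓ) D
      nonempty = Surely-NonEmptyAt P′ ρ′ (fromℕ k) feasible LevelsAbove-upper (c₀ , false)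
      ℓ<k : (toℕ ℓ <ᵇ toℕ (fromℕ k)) ≡ true
      ℓ<k = <⇒<ᵇ≡true (subst (toℕ ℓ ℕ.<_) (sym (Fin.toℕ-fromℕ k)) (Fin.toℕ<n ℓ))
      first-round : ∀ {st} → AfterUpper c₀ (fromℕ k) st × NonEmptyAt P′ ρ′ (fromℕ k) ℓ st → W st ≤ 0ℚ
      first-round {c₁ , flag} (mkAfterUpper X≡ Y≡ _ , nonempty₁) = begin
        W (c₁ , flag)  ≤⟨ W-forced {c₁} {flag} (trans (cong (flag ∨_) ℓ<k) (∨-zeroʳ flag)) nonempty₁ ⟩
        excess c₁      ≡⟨ excess-cong {c₁} {c₀} X≡ Y≡ ⟩
        excess c₀      ≡⟨ excess-initial init ⟩
        0ℚ             ∎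

lemma7 : ∀ (m : ℕ) (nseq : ℕ → ℕ) → Dichotomy m nseq →
         ∀ (k : ℕ) (init : Vec (Fin m) k) (σ₁ : Fin m) (rest : List (Fin m × Fin (suc k))) →
         Valid ((σ₁ , fromℕ k) ∷ rest) →
         ∀ (ℓ : Fin k) →
         𝔼 (run init ((σ₁ , fromℕ k) ∷ rest)) (λ c → lookup (Y c) ℓ)
           ≤ H (nseq (suc (toℕ ℓ))) * 𝔼 (run init ((σ₁ , fromℕ k) ∷ rest)) (λ c → lookup (X c) ℓ)
lemma7 m nseq dichotomy k init σ₁ rest valid ℓ = x-y≤0⇒x≤y (begin
  𝔼 d (λ c → lookup (Y c) ℓ) - H N * 𝔼 d (λ c → lookup (X c) ℓ)
    ≡⟨ cong₂ (λ y x → y - H N * x) (𝔼≡𝔼ℚ d (λ c → lookup (Y c) ℓ)) (𝔼≡𝔼ℚ d (λ c → lookup (X c) ℓ)) ⟩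
  𝔼ℚ d (λ c → ι (lookup (Y c) ℓ)) - H N * 𝔼ℚ d (λ c → ι (lookup (X c) ℓ))
    ≡⟨ 𝔼ℚ-linear d (λ c → ι (lookup (Y c) ℓ)) (H N) (λ c → ι (lookup (X c) ℓ)) ⟨
  𝔼ℚ d (excess ℓ N)
    ≤⟨ 𝔼ℚ-excess-run≤0 ℓ N dichotomyAtℓ init σ₁ rest valid ⟩
  0ℚ ∎)
  where
  open ℚ.≤-Reasoning
  N = nseq (suc (toℕ ℓ))
  d = run init ((σ₁ , fromℕ k) ∷ rest)
  dichotomyAtℓ : DichotomyAt m k ℓ N
  dichotomyAtℓ t ρ P hsp = dichotomy k t ρ P hsp ℓ
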